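{- Let $k\ge 1$ be an integer and let $G$ be a finite, connected, simple graph on $n\ge 4$ vertices. Then $\beta_k(G)=n-2$ if and only if $G$ is one of: $K_{s,t}$ with $s,t\ge 1$; $K_s+\overline{K_t}$ with $s\ge 1$ and $t\ge 2$; $K_s+(K_1\cup K_t)$ with $s,t\ge 1$; or $P_4$ in the case $k=1$.
   Context: For a graph $G=(V,E)$ with geodesic (shortest-path) distance $d$, and an integer $k\ge 0$, define $d_k(u,v):=\min\{d(u,v),k+1\}$. A non-empty set $R\subseteq V$ is a $k$-truncated resolving set of $G$ if for all $u,v\in V$, $d_k(u,r)=d_k(v,r)$ for every $r\in R$ implies $u=v$. The $k$-truncated metric dimension $\beta_k(G)$ is the minimum size of a $k$-truncated resolving set of $G$. Notation: $K_{s,t}$ is the complete bipartite graph with parts of sizes $s,t$; $K_s$ is the complete graph on $s$ vertices and $\overline{K_t}$ the edgeless graph on $t$ vertices; $G\cup H$ is the disjoint union of $G$ and $H$; $G+H$ is the disjoint union of $G$ and $H$ together with all edges between a vertex of $G$ and a vertex of $H$; $P_4$ is the path on 4 vertices. -}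

module Defs where

open import Data.Nat using (ℕ; zero; suc; _≤_; _<_; _≡ᵇ_)
open import Data.Bool using (Bool; true; false; _∨_; not)
open import Data.Fin using (Fin; toℕ; splitAt; _≟_)
open import Data.Fin.Subset using (Subset; _∈_; Nonempty; ∣_∣)
open import Data.Sum using (_⊎_; inj₁; inj₂)
open import Data.Product using (Σ; ∃; _×_; _,_)
open import Relation.Binary.PropositionalEquality using (_≡_)
open import Relation.Nullary using (¬_; does)
open import Function.Bundles using (_↔_; Inverse)

Graph : ℕ → Set
Graph n = Fin n → Fin n → Bool

IsSimple : ∀ {n} → Graph n → Set
IsSimple {n} G = (∀ u v → G u v ≡ G v u) × (∀ u → G u u ≡ false)

data Walk {n : ℕ} (G : Graph n) : Fin n → Fin n → ℕ → Set where
  here : ∀ {u} → Walk G u u 0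
  step : ∀ {u w v m} → G u w ≡ true → Walk G w v m → Walk G u v (suc m)

Connected : ∀ {n} → Graph n → Set
Connected {n} G = ∀ (u v : Fin n) → ∃ λ m → Walk G u v m

Dist : ∀ {n} → Graph n → Fin n → Fin n → ℕ → Set
Dist G u v j = Walk G u v j × (∀ i → i < j → ¬ Walk G u v i)

-- Truncated distance d_k(u,v) = min{d(u,v), k+1} = j  (as a relation; it is functional).
DistK : ∀ {n} → ℕ → Graph n → Fin n → Fin n → ℕ → Set
DistK k G u v j =
  (j ≤ k × Dist G u v j) ⊎ (j ≡ suc k × (∀ i → i ≤ k → ¬ Walk G u v i))

Resolving : ∀ {n} → ℕ → Graph n → Subset n → Set
Resolving {n} k G R =
  Nonempty R ×
  (∀ (u v : Fin n) →
     (∀ r → r ∈ R → ∃ λ j → DistK k G u r j × DistK k G v r j) → u ≡ v)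

MetricDimK : ∀ {n} → ℕ → Graph n → ℕ → Set
MetricDimK {n} k G m =
  (Σ (Subset n) λ R → Resolving k G R × ∣ R ∣ ≡ m) ×
  (∀ (R : Subset n) → Resolving k G R → m ≤ ∣ R ∣)

_≅_ : ∀ {n m} → Graph n → Graph m → Set
_≅_ {n} {m} G H = Σ (Fin n ↔ Fin m) λ f →
  ∀ u v → G u v ≡ H (Inverse.to f u) (Inverse.to f v)

K : (s : ℕ) → Graph s
K s u v = not (does (u ≟ v))

E : (t : ℕ) → Graph t
E t u v = false

_∪G_ : ∀ {m n} → Graph m → Graph n → Graph (m Data.Nat.+ n)
_∪G_ {m} G H u v with splitAt m u | splitAt m v
... | inj₁ a | inj₁ b = G a b
... | inj₂ a | inj₂ b = H a b
... | inj₁ _ | inj₂ _ = false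
... | inj₂ _ | inj₁ _ = false

_+G_ : ∀ {m n} → Graph m → Graph n → Graph (m Data.Nat.+ n)
_+G_ {m} G H u v with splitAt m u | splitAt m v
... | inj₁ a | inj₁ b = G a b
... | inj₂ a | inj₂ b = H a b
... | inj₁ _ | inj₂ _ = true
... | inj₂ _ | inj₁ _ = true

Kbip : (s t : ℕ) → Graph (s Data.Nat.+ t)
Kbip s t = E s +G E t

Path : (n : ℕ) → Graph n
Path n u v = (toℕ u ≡ᵇ suc (toℕ v)) ∨ (toℕ v ≡ᵇ suc (toℕ u))

-- V ∖ {a, b} resolves exactly when a third vertex separates a from b (has different truncated
-- distances to them), and V ∖ {a, b, c}, hence every set avoiding a, b, c, fails to resolve
-- exactly when two of a, b, c agree on all of V ∖ {a, b, c}.  So β_k(G) = n − 2 iff some pair is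
-- separated by a third vertex and every triple contains a pair agreeing outside the triple.
-- As k ≥ 1, an agreeing pair has the same neighbours outside the triple: it is a pair of twins
-- or differs exactly at the third vertex, and twins are never separated.  The graph is thus
-- assembled from its twin classes, and connectivity with the triple condition leaves: two
-- classes, giving K_{s,t} or K_s + \overline{K_t}; three classes inducing a path, giving
-- K_s + (K_1 ∪ K_t); or four singleton classes and no further vertex, forming P_4, which passes
-- the triple condition only for k = 1.  The facts about four and five vertices are finite checks.

module Submission where

open import Defs
open import Data.Bool using (Bool; true; false; not; _∧_; _∨_; _xor_; T)
open import Data.Bool.Properties using (T-∧; T-∨; not-involutive; ¬-not; xor-same) renaming (_≟_ to _≟ᵇ_)
open import Data.Empty using (⊥; ⊥-elim)
open import Data.Fin using (Fin; zero; suc; splitAt; join; _↑ʳ_) renaming (_≟_ to _≟ᶠ_)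
open import Data.Fin.Permutation using (transpose)
import Data.Fin.Permutation.Components as PC
open import Data.Fin.Properties using (all?; any?; ¬∀⟶∃¬; splitAt-↑ʳ; splitAt-join; join-splitAt; +↔⊎)
  renaming (suc-injective to fsuc-injective)
open import Data.Fin.Subset using (Subset; _∈_; _∉_; _-_; ⊤; ∁; ∣_∣; Nonempty; inside; outside)
open import Data.Fin.Subset.Properties
  using (_∈?_; ∈⊤; p─⊥≡p; p─q⊆p; x∈p∧x≢y⇒x∈p-y; nonempty?; Empty-unique; ∣⊥∣≡0; ∣⊤∣≡n; x∈∁p⇒x∉p; ∣∁p∣≡n∸∣p∣)
open import Data.Nat using (ℕ; zero; suc; _+_; _∸_; _≤_; _<_; z≤n; s≤s; s≤s⁻¹; _≤?_)
open import Data.Nat.Properties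
  using (+-identityʳ; +-suc; suc-injective; m≤m+n; m≤n⇒m<n∨m≡n; ≤-pred; <-cmp; ≤-<-trans; ≤-trans; n≤1+n; ≤-refl;
         m∸[m∸n]≡n; m∸n≤m; ∸-monoʳ-<; ≰⇒>; <⇒≱; n<1+n; ≤-reflexive; ≤∧≢⇒<)
  renaming (_≟_ to _≟ⁿ_)
open import Data.Product using (Σ; ∃; ∃₂; _×_; _,_; proj₁; proj₂)
open import Data.Sum as Sum using (_⊎_; inj₁; inj₂; swap)
open import Data.Sum.Algebra using (⊎-comm)
open import Data.Sum.Function.Propositional using (_⊎-↔_)
open import Data.Unit using (tt) renaming (⊤ to Unit)
open import Data.Vec using (Vec; []; _∷_; lookup; tabulate; here; there)
open import Data.Vec.Membership.Propositional using () renaming (_∈_ to _∈ⱽ_)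
import Data.Vec.Membership.DecPropositional as DecMembership
open import Data.Vec.Properties using (lookup∘tabulate)
open import Data.Vec.Relation.Unary.All using (All; []; _∷_)
open import Data.Vec.Relation.Unary.All.Properties using (lookup⁺)
open import Data.Vec.Relation.Unary.AllPairs using (AllPairs; []; _∷_)
import Data.Vec.Relation.Unary.AllPairs as AllPairs
open import Data.Vec.Relation.Unary.Any using (index; here; there)
open import Data.Vec.Relation.Unary.Any.Properties using (lookup-index)
open import Data.Vec.Relation.Unary.Unique.Propositional using (Unique)
open import Data.Vec.Relation.Unary.Unique.Propositional.Properties using (lookup-injective)
open import Function using (_∘_; id; _⇔_; mk⇔; Equivalence)
open import Function.Bundles using (_↔_; Inverse; Injection; mk↔ₛ′)
open import Function.Construct.Composition using (_⇔-∘_)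
open import Function.Properties.Inverse using (↔-refl; ↔-sym; ↔-trans; ↔⇒↣)
open import Relation.Binary using (tri<; tri≈; tri>)
open import Relation.Binary.PropositionalEquality using (_≡_; _≢_; refl; sym; trans; subst; cong; cong₂)
open import Relation.Nullary using (¬_; Dec; yes; no; does; contradiction)
open import Relation.Nullary.Decidable using (¬?; _→-dec_; _×-dec_; _⊎-dec_; map′; toWitness; dec-true; dec-false)

private variable
  m : ℕ
  p : Subset m
  w x y z : Fin m

module TruncatedDistance {n : ℕ} (k : ℕ) (G : Graph n) where

  walk? : ∀ m u v → Dec (Walk G u v m)
  walk? zero u v with u ≟ᶠ v
  ... | yes refl = yes here
  ... | no u≢v = no λ { here → u≢v refl }
  walk? (suc m) u v with any? (λ w → (G u w ≟ᵇ true) ×-dec walk? m w v)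
  ... | yes (w , uw , p) = yes (step uw p)
  ... | no ∄w = no λ { (step {w = w} uw p) → ∄w (w , uw , p) }

  shortestFrom : (j fuel : ℕ) → Fin n → Fin n → ℕ
  shortestFrom j zero u v = j
  shortestFrom j (suc fuel) u v with walk? j u v
  ... | yes _ = j
  ... | no _ = shortestFrom (suc j) fuel u v

  dₖ : Fin n → Fin n → ℕ
  dₖ = shortestFrom 0 (suc k)

  shortestFrom-DistK : ∀ j fuel u v → j + fuel ≡ suc k → (∀ i → i < j → ¬ Walk G u v i) →
                       DistK k G u v (shortestFrom j fuel u v)
  shortestFrom-DistK j zero u v j+0≡1+k none =
    inj₂ (j≡1+k , λ i i≤k → none i (subst (i <_) (sym j≡1+k) (s≤s i≤k)))
    where
      j≡1+k : j ≡ suc k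
      j≡1+k = trans (sym (+-identityʳ j)) j+0≡1+k
  shortestFrom-DistK j (suc fuel) u v eq none with walk? j u v
  ... | yes w = inj₁ (subst (j ≤_) (suc-injective (trans (sym (+-suc j fuel)) eq)) (m≤m+n j fuel) , w , none)
  ... | no ¬w = shortestFrom-DistK (suc j) fuel u v (trans (sym (+-suc j fuel)) eq) none′
    where
      none′ : ∀ i → i < suc j → ¬ Walk G u v i
      none′ i i<1+j with m≤n⇒m<n∨m≡n (≤-pred i<1+j)
      ... | inj₁ i<j = none i i<j
      ... | inj₂ refl = ¬w

  dₖ-DistK : ∀ u v → DistK k G u v (dₖ u v)
  dₖ-DistK u v = shortestFrom-DistK 0 (suc k) u v refl (λ _ ())

  DistK-functional : ∀ {u v i j} → DistK k G u v i → DistK k G u v j → i ≡ j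
  DistK-functional (inj₁ (_ , wi , ¬<i)) (inj₁ (_ , wj , ¬<j)) with <-cmp _ _
  ... | tri< i<j _ _ = ⊥-elim (¬<j _ i<j wi)
  ... | tri≈ _ i≡j _ = i≡j
  ... | tri> _ _ j<i = ⊥-elim (¬<i _ j<i wj)
  DistK-functional (inj₁ (i≤k , wi , _)) (inj₂ (_ , none)) = ⊥-elim (none _ i≤k wi)
  DistK-functional (inj₂ (_ , none)) (inj₁ (j≤k , wj , _)) = ⊥-elim (none _ j≤k wj)
  DistK-functional (inj₂ (i≡1+k , _)) (inj₂ (j≡1+k , _)) = trans i≡1+k (sym j≡1+k)

  DistK⇒dₖ : ∀ {u v j} → DistK k G u v j → dₖ u v ≡ j
  DistK⇒dₖ = DistK-functional (dₖ-DistK _ _)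

  sameDistK⇒dₖ≡ : ∀ {r x y} → (∃ λ j → DistK k G x r j × DistK k G y r j) → dₖ x r ≡ dₖ y r
  sameDistK⇒dₖ≡ (j , x-r , y-r) = trans (DistK⇒dₖ x-r) (sym (DistK⇒dₖ y-r))

  dₖ≡⇒sameDistK : ∀ {r x y} → dₖ x r ≡ dₖ y r → ∃ λ j → DistK k G x r j × DistK k G y r j
  dₖ≡⇒sameDistK {r} {x} {y} eq = dₖ x r , dₖ-DistK x r , subst (DistK k G y r) (sym eq) (dₖ-DistK y r)

module SimpleGraph {n : ℕ} {G : Graph n} (simple : IsSimple G) where

  adjacency-sym : ∀ u v → G u v ≡ G v u
  adjacency-sym = proj₁ simple

  adjacent⇒≢ : ∀ {u v} → G u v ≡ true → u ≢ v
  adjacent⇒≢ {u} uv refl = contradiction (trans (sym (proj₂ simple u)) uv) λ ()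

  module Distances (k : ℕ) (1≤k : 1 ≤ k) where
    open TruncatedDistance k G public

    dₖ-refl : ∀ u → dₖ u u ≡ 0
    dₖ-refl u = DistK⇒dₖ {u} {u} (inj₁ (z≤n , here , λ _ ()))

    dₖ≡0⇒≡ : ∀ {u v} → dₖ u v ≡ 0 → u ≡ v
    dₖ≡0⇒≡ {u} {v} d≡0 with subst (DistK k G u v) d≡0 (dₖ-DistK u v)
    ... | inj₁ (_ , here , _) = refl

    adjacent⇒dₖ≡1 : ∀ {u v} → G u v ≡ true → dₖ u v ≡ 1
    adjacent⇒dₖ≡1 {u} {v} uv =
      DistK⇒dₖ {u} {v} (inj₁ (1≤k , step uv here , λ { zero _ here → adjacent⇒≢ uv refl ; (suc _) (s≤s ()) }))

    dₖ≡1⇒adjacent : ∀ {u v} → dₖ u v ≡ 1 → G u v ≡ true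
    dₖ≡1⇒adjacent {u} {v} d≡1 with subst (DistK k G u v) d≡1 (dₖ-DistK u v)
    ... | inj₁ (_ , step uv here , _) = uv
    ... | inj₂ (1≡1+k , _) = contradiction (subst (1 ≤_) (sym (suc-injective 1≡1+k)) 1≤k) λ ()

    -- Adjacency is distance 1, which truncation at k ≥ 1 does not hide.
    dₖ≡⇒adjacency≡ : ∀ {x y r} → dₖ x r ≡ dₖ y r → G x r ≡ G y r
    dₖ≡⇒adjacency≡ {x} {y} {r} eq with G x r in xr | G y r in yr
    ... | true | true = refl
    ... | false | false = refl
    ... | true | false = contradiction (trans (sym yr) (dₖ≡1⇒adjacent (trans (sym eq) (adjacent⇒dₖ≡1 xr)))) λ ()
    ... | false | true = contradiction (trans (sym xr) (dₖ≡1⇒adjacent (trans eq (adjacent⇒dₖ≡1 yr)))) λ ()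

    nonadjacent⇒dₖ≡2 : k ≡ 1 → ∀ {u v} → u ≢ v → G u v ≡ false → dₖ u v ≡ 2
    nonadjacent⇒dₖ≡2 refl {u} {v} u≢v uv = DistK⇒dₖ {u} {v} (inj₂ (refl , λ where
      zero _ here → u≢v refl
      (suc zero) _ (step uv′ here) → contradiction (trans (sym uv) uv′) λ ()
      (suc (suc _)) (s≤s ()) _))

    adjacency≡⇒dₖ≡ : k ≡ 1 → ∀ {x y r} → x ≢ r → y ≢ r → G x r ≡ G y r → dₖ x r ≡ dₖ y r
    adjacency≡⇒dₖ≡ k≡1 {x} {y} {r} x≢r y≢r eq with G x r in xr
    ... | true = trans (adjacent⇒dₖ≡1 xr) (sym (adjacent⇒dₖ≡1 (sym eq)))
    ... | false = trans (nonadjacent⇒dₖ≡2 k≡1 x≢r xr) (sym (nonadjacent⇒dₖ≡2 k≡1 y≢r (sym eq)))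

    common-neighbour⇒dₖ≡2 : 2 ≤ k → ∀ {u w v} → u ≢ v → G u v ≡ false → G u w ≡ true → G w v ≡ true → dₖ u v ≡ 2
    common-neighbour⇒dₖ≡2 2≤k {u} {w} {v} u≢v uv uw wv = DistK⇒dₖ {u} {v} (inj₁ (2≤k , step uw (step wv here) , λ where
      zero _ here → u≢v refl
      (suc zero) _ (step uv′ here) → contradiction (trans (sym uv) uv′) λ ()
      (suc (suc _)) (s≤s (s≤s ())) _))

    dₖ≡2⇒common-neighbour : 2 ≤ k → ∀ {u v} → dₖ u v ≡ 2 → ∃ λ w → G u w ≡ true × G w v ≡ true
    dₖ≡2⇒common-neighbour 2≤k {u} {v} d≡2 with subst (DistK k G u v) d≡2 (dₖ-DistK u v)
    ... | inj₁ (_ , step uw (step wv here) , _) = _ , uw , wv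
    ... | inj₂ (2≡1+k , _) = contradiction (subst (2 ≤_) (sym (suc-injective 2≡1+k)) 2≤k) λ { (s≤s ()) }

module Twin {n : ℕ} {G : Graph n} (simple : IsSimple G) where
  open SimpleGraph simple

  Twins : Fin n → Fin n → Set
  Twins x y = ∀ r → r ≢ x → r ≢ y → G x r ≡ G y r

  twins? : ∀ x y → Dec (Twins x y)
  twins? x y = map′ (λ t r → t r) (λ t r → t r)
    (all? λ r → ¬? (r ≟ᶠ x) →-dec (¬? (r ≟ᶠ y) →-dec (G x r ≟ᵇ G y r)))

  ≡⇒twins : ∀ {x y} → x ≡ y → Twins x y
  ≡⇒twins refl _ _ _ = refl

  twins-refl : ∀ {x} → Twins x x
  twins-refl = ≡⇒twins refl

  twins-sym : ∀ {x y} → Twins x y → Twins y x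
  twins-sym t r r≢y r≢x = sym (t r r≢x r≢y)

  twins-trans : ∀ {x y z} → Twins x y → Twins y z → Twins x z
  twins-trans {x} {y} {z} xy yz with x ≟ᶠ y | y ≟ᶠ z
  ... | yes refl | _ = yz
  ... | no _ | yes refl = xy
  ... | no x≢y | no y≢z = λ r r≢x r≢z → via r r≢x r≢z
    where
      via : ∀ r → r ≢ x → r ≢ z → G x r ≡ G z r
      via r r≢x r≢z with r ≟ᶠ y
      ... | no r≢y = trans (xy r r≢x r≢y) (yz r r≢y r≢z)
      ... | yes refl with x ≟ᶠ z
      ...   | yes refl = refl
      ...   | no x≢z = trans (adjacency-sym x r) (trans (yz x x≢y x≢z)
                         (trans (adjacency-sym z x) (trans (xy z (x≢z ∘ sym) (y≢z ∘ sym)) (adjacency-sym r z))))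

  ¬twins⇒≢ : ∀ {x y} → ¬ Twins x y → x ≢ y
  ¬twins⇒≢ ¬t = ¬t ∘ ≡⇒twins

  twins-adjacency : ∀ {x x′ y y′} → Twins x x′ → Twins y y′ → ¬ Twins x y → G x y ≡ G x′ y′
  twins-adjacency {x} {x′} {y} {y′} xx′ yy′ ¬xy = trans x-side y-side
    where
      y≢x′ : y ≢ x′
      y≢x′ refl = ¬xy xx′
      x′≢y′ : x′ ≢ y′
      x′≢y′ refl = ¬xy (twins-trans xx′ (twins-sym yy′))
      x-side : G x y ≡ G x′ y
      x-side with x ≟ᶠ x′
      ... | yes refl = refl
      ... | no _ = xx′ y (¬twins⇒≢ ¬xy ∘ sym) y≢x′
      y-side : G x′ y ≡ G x′ y′
      y-side with y ≟ᶠ y′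
      ... | yes refl = refl
      ... | no _ = trans (adjacency-sym x′ y) (trans (yy′ x′ (y≢x′ ∘ sym) x′≢y′) (adjacency-sym y′ x′))

  cross-adjacency : ∀ {p q u v} → Twins u p → Twins v q → ¬ Twins p q → G u v ≡ G p q
  cross-adjacency up vq ¬pq = sym (twins-adjacency (twins-sym up) (twins-sym vq) ¬pq)

  ¬twins⇒witness : ∀ {x y} → ¬ Twins x y → ∃ λ r → r ≢ x × r ≢ y × G x r ≢ G y r
  ¬twins⇒witness {x} {y} ¬xy
    with ¬∀⟶∃¬ n (λ r → r ≢ x → r ≢ y → G x r ≡ G y r)
                 (λ r → ¬? (r ≟ᶠ x) →-dec (¬? (r ≟ᶠ y) →-dec (G x r ≟ᵇ G y r))) (λ t → ¬xy λ r → t r)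
  ... | r , ¬agree with r ≟ᶠ x | r ≟ᶠ y
  ...   | yes r≡x | _ = ⊥-elim (¬agree λ r≢x → ⊥-elim (r≢x r≡x))
  ...   | no _ | yes r≡y = ⊥-elim (¬agree λ _ r≢y → ⊥-elim (r≢y r≡y))
  ...   | no r≢x | no r≢y = r , r≢x , r≢y , λ eq → ¬agree λ _ _ → eq

  twin-class-common : ∀ {p a b c} → Twins a p → Twins b p → Twins c p → a ≢ b → a ≢ c → G a b ≡ G a c
  twin-class-common {p} {a} {b} {c} ap bp cp a≢b a≢c with b ≟ᶠ c
  ... | yes refl = refl
  ... | no b≢c = trans (ac b (a≢b ∘ sym) b≢c) (trans (adjacency-sym c b) (sym (ab c (a≢c ∘ sym) (b≢c ∘ sym))))
    where
      ab : Twins a b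
      ab = twins-trans ap (twins-sym bp)
      ac : Twins a c
      ac = twins-trans ap (twins-sym cp)

  twin-class-uniform : ∀ {p u v u′ v′} → Twins u p → Twins v p → Twins u′ p → Twins v′ p →
                       u ≢ v → u′ ≢ v′ → G u v ≡ G u′ v′
  twin-class-uniform {p} {u} {v} {u′} {v′} up vp u′p v′p u≢v u′≢v′ with u ≟ᶠ v′
  ... | yes refl = trans (twin-class-common up vp u′p u≢v (u′≢v′ ∘ sym)) (adjacency-sym u u′)
  ... | no u≢v′ = trans (twin-class-common up vp v′p u≢v u≢v′)
                   (trans (adjacency-sym u v′)
                     (trans (twin-class-common v′p up u′p (u≢v′ ∘ sym) (u′≢v′ ∘ sym)) (adjacency-sym v′ u′)))

  twin-walk : ∀ {x y r m} → Twins x y → r ≢ x → r ≢ y → Walk G x r m → ∃ λ m′ → m′ ≤ m × Walk G y r m′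
  twin-walk _ r≢x _ here = ⊥-elim (r≢x refl)
  twin-walk {x} {y} {r} {suc m} xy r≢x r≢y (step {w = w} xw p) with w ≟ᶠ y
  ... | yes refl = m , n≤1+n m , p
  ... | no w≢y = suc m , ≤-refl , step (trans (sym (xy w (adjacent⇒≢ xw ∘ sym) w≢y)) xw) p

  module TwinDistances (k : ℕ) (1≤k : 1 ≤ k) where
    open Distances k 1≤k

    twins-DistK : ∀ {x y r j} → Twins x y → r ≢ x → r ≢ y → DistK k G x r j → DistK k G y r j
    twins-DistK {x} {y} {r} xy r≢x r≢y = transport
      where
        back : ∀ {i} → Walk G y r i → ∃ λ i′ → i′ ≤ i × Walk G x r i′
        back = twin-walk (twins-sym xy) r≢y r≢x
        transport : ∀ {j} → DistK k G x r j → DistK k G y r j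
        transport (inj₁ (j≤k , w , ¬<j)) with twin-walk xy r≢x r≢y w
        ... | j′ , j′≤j , w′ with m≤n⇒m<n∨m≡n j′≤j
        ...   | inj₂ refl = inj₁ (j≤k , w′ , λ i i<j wy → let (i′ , i′≤i , wx) = back wy in ¬<j i′ (≤-<-trans i′≤i i<j) wx)
        ...   | inj₁ j′<j = let (i′ , i′≤j′ , wx) = back w′ in ⊥-elim (¬<j i′ (≤-<-trans i′≤j′ j′<j) wx)
        transport (inj₂ (j≡1+k , none)) =
          inj₂ (j≡1+k , λ i i≤k wy → let (i′ , i′≤i , wx) = back wy in none i′ (≤-trans i′≤i i≤k) wx)

    twins⇒dₖ≡ : ∀ {x y r} → Twins x y → r ≢ x → r ≢ y → dₖ x r ≡ dₖ y r
    twins⇒dₖ≡ {x} xy r≢x r≢y = sym (DistK⇒dₖ (twins-DistK xy r≢x r≢y (dₖ-DistK x _)))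

x∈p-y⇒x∈p : x ∈ p - y → x ∈ p
x∈p-y⇒x∈p {p = p} {y = y} = p─q⊆p p _

x∈p-y⇒x≢y : x ∈ p - y → x ≢ y
x∈p-y⇒x≢y {x = zero} {p = _ ∷ _} {y = zero} () refl
x∈p-y⇒x≢y {x = suc x} {p = _ ∷ _} {y = suc y} (there x∈p-y) refl = x∈p-y⇒x≢y x∈p-y refl

x∈p⇒∣p-x∣+1≡∣p∣ : x ∈ p → suc ∣ p - x ∣ ≡ ∣ p ∣
x∈p⇒∣p-x∣+1≡∣p∣ {x = zero} {p = inside ∷ p} here = cong (suc ∘ ∣_∣) (p─⊥≡p p)
x∈p⇒∣p-x∣+1≡∣p∣ {x = suc x} {p = inside ∷ p} (there x∈p) = cong suc (x∈p⇒∣p-x∣+1≡∣p∣ x∈p)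
x∈p⇒∣p-x∣+1≡∣p∣ {x = suc x} {p = outside ∷ p} (there x∈p) = x∈p⇒∣p-x∣+1≡∣p∣ x∈p

∣p∣>0⇒nonempty : 0 < ∣ p ∣ → Nonempty p
∣p∣>0⇒nonempty {m} {p} 0<∣p∣ with nonempty? p
... | yes ne = ne
... | no empty = contradiction (subst (λ q → 0 < ∣ q ∣) (Empty-unique empty) 0<∣p∣)
                               (λ 0<∣⊥∣ → contradiction (subst (0 <_) (∣⊥∣≡0 m) 0<∣⊥∣) λ ())

two-members : 2 ≤ ∣ p ∣ → ∃₂ λ a b → a ∈ p × b ∈ p × a ≢ b
two-members {p = p} 2≤∣p∣ with ∣p∣>0⇒nonempty (≤-trans (s≤s z≤n) 2≤∣p∣)
... | a , a∈p with ∣p∣>0⇒nonempty {p = p - a} (s≤s⁻¹ (subst (2 ≤_) (sym (x∈p⇒∣p-x∣+1≡∣p∣ a∈p)) 2≤∣p∣))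
...   | b , b∈p-a = a , b , a∈p , x∈p-y⇒x∈p b∈p-a , x∈p-y⇒x≢y b∈p-a ∘ sym

three-members : 3 ≤ ∣ p ∣ → ∃₂ λ a b → ∃ λ c → a ∈ p × b ∈ p × c ∈ p × a ≢ b × a ≢ c × b ≢ c
three-members {p = p} 3≤∣p∣ with ∣p∣>0⇒nonempty (≤-trans (s≤s z≤n) 3≤∣p∣)
... | a , a∈p with two-members {p = p - a} (s≤s⁻¹ (subst (3 ≤_) (sym (x∈p⇒∣p-x∣+1≡∣p∣ a∈p)) 3≤∣p∣))
...   | b , c , b∈p-a , c∈p-a , b≢c =
  a , b , c , a∈p , x∈p-y⇒x∈p b∈p-a , x∈p-y⇒x∈p c∈p-a , x∈p-y⇒x≢y b∈p-a ∘ sym , x∈p-y⇒x≢y c∈p-a ∘ sym , b≢c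

∈⊤-x-y : z ≢ x → z ≢ y → z ∈ ⊤ - x - y
∈⊤-x-y z≢x z≢y = x∈p∧x≢y⇒x∈p-y (x∈p∧x≢y⇒x∈p-y ∈⊤ z≢x) z≢y

∉⊤-x-y : z ∉ ⊤ - x - y → z ≡ x ⊎ z ≡ y
∉⊤-x-y {z = z} {x} {y} z∉ with z ≟ᶠ x | z ≟ᶠ y
... | yes z≡x | _ = inj₁ z≡x
... | no _ | yes z≡y = inj₂ z≡y
... | no z≢x | no z≢y = contradiction (∈⊤-x-y z≢x z≢y) z∉

∣⊤-x-y∣+2≡m : y ≢ x → suc (suc ∣ ⊤ {m} - x - y ∣) ≡ m
∣⊤-x-y∣+2≡m {m = m} {x = x} y≢x =
  trans (cong suc (x∈p⇒∣p-x∣+1≡∣p∣ (x∈p∧x≢y⇒x∈p-y ∈⊤ y≢x)))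
        (trans (x∈p⇒∣p-x∣+1≡∣p∣ {x = x} ∈⊤) (∣⊤∣≡n m))

∈⊤-x-y-w : z ≢ x → z ≢ y → z ≢ w → z ∈ ⊤ - x - y - w
∈⊤-x-y-w z≢x z≢y z≢w = x∈p∧x≢y⇒x∈p-y (∈⊤-x-y z≢x z≢y) z≢w

∉⊤-x-y-w : z ∉ ⊤ - x - y - w → z ≡ x ⊎ z ≡ y ⊎ z ≡ w
∉⊤-x-y-w {z = z} {w = w} z∉ with z ≟ᶠ w
... | yes z≡w = inj₂ (inj₂ z≡w)
... | no z≢w = Sum.map₂ inj₁ (∉⊤-x-y (z∉ ∘ λ z∈ → x∈p∧x≢y⇒x∈p-y z∈ z≢w))

∣⊤-x-y-w∣+3≡m : y ≢ x → w ≢ x → w ≢ y → suc (suc (suc ∣ ⊤ {m} - x - y - w ∣)) ≡ m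
∣⊤-x-y-w∣+3≡m y≢x w≢x w≢y =
  trans (cong (λ (s : ℕ) → suc (suc s)) (x∈p⇒∣p-x∣+1≡∣p∣ (∈⊤-x-y w≢x w≢y))) (∣⊤-x-y∣+2≡m y≢x)

third-element : ∀ {m} {x y : Fin m} → 3 ≤ m → x ≢ y → ∃ λ z → z ≢ x × z ≢ y
third-element {m = m} {x = x} {y = y} 3≤m x≢y
  with ∣p∣>0⇒nonempty {p = ⊤ {m} - x - y} (s≤s⁻¹ (s≤s⁻¹ (subst (3 ≤_) (sym (∣⊤-x-y∣+2≡m (x≢y ∘ sym))) 3≤m)))
... | z , z∈ = z , x∈p-y⇒x≢y (x∈p-y⇒x∈p z∈) , x∈p-y⇒x≢y z∈

module Resolvability {n : ℕ} {G : Graph n} (simple : IsSimple G) (k : ℕ) (1≤k : 1 ≤ k) where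
  open SimpleGraph simple
  open Distances k 1≤k

  UnresolvedOutside : Fin n → Fin n → Fin n → Set
  UnresolvedOutside x y z = ∀ r → r ≢ x → r ≢ y → r ≢ z → dₖ x r ≡ dₖ y r

  unresolvedOutside? : ∀ x y z → Dec (UnresolvedOutside x y z)
  unresolvedOutside? x y z = map′ (λ h r → h r) (λ h r → h r)
    (all? λ r → ¬? (r ≟ᶠ x) →-dec (¬? (r ≟ᶠ y) →-dec (¬? (r ≟ᶠ z) →-dec (dₖ x r ≟ⁿ dₖ y r))))

  HasUnresolvedPair : Fin n → Fin n → Fin n → Set
  HasUnresolvedPair a b c = UnresolvedOutside a b c ⊎ UnresolvedOutside a c b ⊎ UnresolvedOutside b c a

  EveryTripleHasUnresolvedPair : Set
  EveryTripleHasUnresolvedPair = ∀ a b c → a ≢ b → a ≢ c → b ≢ c → HasUnresolvedPair a b c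

  SomePairResolvedByAThird : Set
  SomePairResolvedByAThird = ∃₂ λ a b → ∃ λ r → a ≢ b × r ≢ a × r ≢ b × dₖ a r ≢ dₖ b r

  -- Members of R are resolved by themselves, so only pairs of non-members need a witness.
  resolving-by-nonmembers : ∀ R → Nonempty R →
    (∀ u v → u ∉ R → v ∉ R → (∀ r → r ∈ R → dₖ u r ≡ dₖ v r) → u ≡ v) → Resolving k G R
  resolving-by-nonmembers R nonempty separated = nonempty , λ u v same → resolve u v (λ r r∈R → sameDistK⇒dₖ≡ (same r r∈R))
    where
      resolve : ∀ u v → (∀ r → r ∈ R → dₖ u r ≡ dₖ v r) → u ≡ v
      resolve u v same with u ∈? R | v ∈? R
      ... | yes u∈R | _ = sym (dₖ≡0⇒≡ (trans (sym (same u u∈R)) (dₖ-refl u)))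
      ... | no _ | yes v∈R = dₖ≡0⇒≡ (trans (same v v∈R) (dₖ-refl v))
      ... | no u∉R | no v∉R = separated u v u∉R v∉R same

  resolving-unique : ∀ {R u v} → Resolving k G R → (∀ r → r ∈ R → dₖ u r ≡ dₖ v r) → u ≡ v
  resolving-unique (_ , resolves) same = resolves _ _ λ r r∈R → dₖ≡⇒sameDistK (same r r∈R)

  resolving-separates : ∀ {R u v} → Resolving k G R → u ≢ v → ∃ λ r → r ∈ R × dₖ u r ≢ dₖ v r
  resolving-separates {R} {u} {v} resolving u≢v
    with ¬∀⟶∃¬ n (λ r → r ∈ R → dₖ u r ≡ dₖ v r) (λ r → (r ∈? R) →-dec (dₖ u r ≟ⁿ dₖ v r))
                 (u≢v ∘ resolving-unique resolving)
  ... | r , ¬same with r ∈? R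
  ...   | yes r∈R = r , r∈R , ¬same ∘ λ eq _ → eq
  ...   | no r∉R = ⊥-elim (¬same λ r∈R → contradiction r∈R r∉R)

  resolving-⊤-a-b : ∀ {a b r} → a ≢ b → r ≢ a → r ≢ b → dₖ a r ≢ dₖ b r → Resolving k G (⊤ - a - b)
  resolving-⊤-a-b {a} {b} {r} a≢b r≢a r≢b a≁b = resolving-by-nonmembers _ (r , ∈⊤-x-y r≢a r≢b) λ u v u∉ v∉ same →
    separated (∉⊤-x-y u∉) (∉⊤-x-y v∉) (same r (∈⊤-x-y r≢a r≢b))
    where
      separated : ∀ {u v} → u ≡ a ⊎ u ≡ b → v ≡ a ⊎ v ≡ b → dₖ u r ≡ dₖ v r → u ≡ v
      separated (inj₁ refl) (inj₁ refl) _ = refl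
      separated (inj₂ refl) (inj₂ refl) _ = refl
      separated (inj₁ refl) (inj₂ refl) eq = ⊥-elim (a≁b eq)
      separated (inj₂ refl) (inj₁ refl) eq = ⊥-elim (a≁b (sym eq))

  resolving-⊤-a-b-c : ∀ {a b c} → 4 ≤ n → a ≢ b → a ≢ c → b ≢ c → ¬ HasUnresolvedPair a b c →
                      Resolving k G (⊤ - a - b - c)
  resolving-⊤-a-b-c {a} {b} {c} 4≤n a≢b a≢c b≢c none = resolving-by-nonmembers _ nonempty λ u v u∉ v∉ same →
    separated (∉⊤-x-y-w u∉) (∉⊤-x-y-w v∉) (λ r r≢a r≢b r≢c → same r (∈⊤-x-y-w r≢a r≢b r≢c))
    where
      nonempty : Nonempty (⊤ - a - b - c)
      nonempty = ∣p∣>0⇒nonempty (s≤s⁻¹ (s≤s⁻¹ (s≤s⁻¹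
                   (subst (4 ≤_) (sym (∣⊤-x-y-w∣+3≡m (a≢b ∘ sym) (a≢c ∘ sym) (b≢c ∘ sym))) 4≤n))))
      separated : ∀ {u v} → u ≡ a ⊎ u ≡ b ⊎ u ≡ c → v ≡ a ⊎ v ≡ b ⊎ v ≡ c →
                  (∀ r → r ≢ a → r ≢ b → r ≢ c → dₖ u r ≡ dₖ v r) → u ≡ v
      separated (inj₁ refl) (inj₁ refl) _ = refl
      separated (inj₂ (inj₁ refl)) (inj₂ (inj₁ refl)) _ = refl
      separated (inj₂ (inj₂ refl)) (inj₂ (inj₂ refl)) _ = refl
      separated (inj₁ refl) (inj₂ (inj₁ refl)) same = ⊥-elim (none (inj₁ same))
      separated (inj₂ (inj₁ refl)) (inj₁ refl) same = ⊥-elim (none (inj₁ λ r r≢a r≢b r≢c → sym (same r r≢a r≢b r≢c)))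
      separated (inj₁ refl) (inj₂ (inj₂ refl)) same = ⊥-elim (none (inj₂ (inj₁ λ r r≢a r≢c r≢b → same r r≢a r≢b r≢c)))
      separated (inj₂ (inj₂ refl)) (inj₁ refl) same = ⊥-elim (none (inj₂ (inj₁ λ r r≢a r≢c r≢b → sym (same r r≢a r≢b r≢c))))
      separated (inj₂ (inj₁ refl)) (inj₂ (inj₂ refl)) same = ⊥-elim (none (inj₂ (inj₂ λ r r≢b r≢c r≢a → same r r≢a r≢b r≢c)))
      separated (inj₂ (inj₂ refl)) (inj₂ (inj₁ refl)) same = ⊥-elim (none (inj₂ (inj₂ λ r r≢b r≢c r≢a → sym (same r r≢a r≢b r≢c))))

  unresolved-outside-R : ∀ {R x y z} → Resolving k G R → x ∉ R → y ∉ R → z ∉ R →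
                         UnresolvedOutside x y z → x ≡ y
  unresolved-outside-R resolving x∉R y∉R z∉R unresolved = resolving-unique resolving λ r r∈R →
    unresolved r (λ { refl → x∉R r∈R }) (λ { refl → y∉R r∈R }) (λ { refl → z∉R r∈R })

  module _ (4≤n : 4 ≤ n) where

    2≤n : 2 ≤ n
    2≤n = ≤-trans (s≤s (s≤s z≤n)) 4≤n

    small-sets-not-resolving : EveryTripleHasUnresolvedPair → ∀ R → ∣ R ∣ < n ∸ 2 → ¬ Resolving k G R
    small-sets-not-resolving triples R small resolving with three-members {p = ∁ R} three-outside
      where
        three-outside : 3 ≤ ∣ ∁ R ∣
        three-outside = subst (3 ≤_) (sym (∣∁p∣≡n∸∣p∣ R))
          (subst (_< n ∸ ∣ R ∣) (m∸[m∸n]≡n 2≤n) (∸-monoʳ-< small (m∸n≤m n 2)))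
    ... | a , b , c , a∈ , b∈ , c∈ , a≢b , a≢c , b≢c with x∈∁p⇒x∉p a∈ | x∈∁p⇒x∉p b∈ | x∈∁p⇒x∉p c∈
    ...   | a∉ | b∉ | c∉ with triples a b c a≢b a≢c b≢c
    ...     | inj₁ ab = a≢b (unresolved-outside-R resolving a∉ b∉ c∉ ab)
    ...     | inj₂ (inj₁ ac) = a≢c (unresolved-outside-R resolving a∉ c∉ b∉ ac)
    ...     | inj₂ (inj₂ bc) = b≢c (unresolved-outside-R resolving b∉ c∉ a∉ bc)

    resolving-lower-bound : EveryTripleHasUnresolvedPair → ∀ R → Resolving k G R → n ∸ 2 ≤ ∣ R ∣
    resolving-lower-bound triples R resolving with n ∸ 2 ≤? ∣ R ∣
    ... | yes bound = bound
    ... | no ¬bound = ⊥-elim (small-sets-not-resolving triples R (≰⇒> ¬bound) resolving)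

    dimension⇒resolved-pair : MetricDimK k G (n ∸ 2) → SomePairResolvedByAThird
    dimension⇒resolved-pair ((R , resolving , ∣R∣≡n∸2) , _) with two-members {p = ∁ R} two-outside
      where
        two-outside : 2 ≤ ∣ ∁ R ∣
        two-outside = ≤-reflexive (sym (trans (∣∁p∣≡n∸∣p∣ R) (trans (cong (n ∸_) ∣R∣≡n∸2) (m∸[m∸n]≡n 2≤n))))
    ... | a , b , a∈ , b∈ , a≢b with resolving-separates resolving a≢b
    ...   | r , r∈R , a≁b = a , b , r , a≢b , (λ { refl → x∈∁p⇒x∉p a∈ r∈R }) , (λ { refl → x∈∁p⇒x∉p b∈ r∈R }) , a≁b

    dimension⇒every-triple : MetricDimK k G (n ∸ 2) → EveryTripleHasUnresolvedPair
    dimension⇒every-triple (_ , minimal) a b c a≢b a≢c b≢c with unresolvedOutside? a b c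
      ⊎-dec (unresolvedOutside? a c b ⊎-dec unresolvedOutside? b c a)
    ... | yes some = some
    ... | no none = ⊥-elim (<⇒≱ smaller (minimal _ (resolving-⊤-a-b-c 4≤n a≢b a≢c b≢c none)))
      where
        smaller : ∣ ⊤ - a - b - c ∣ < n ∸ 2
        smaller = subst (λ m → ∣ ⊤ - a - b - c ∣ < m ∸ 2)
                        (∣⊤-x-y-w∣+3≡m (a≢b ∘ sym) (a≢c ∘ sym) (b≢c ∘ sym)) (n<1+n _)

    conditions⇒dimension : SomePairResolvedByAThird → EveryTripleHasUnresolvedPair → MetricDimK k G (n ∸ 2)
    conditions⇒dimension (a , b , r , a≢b , r≢a , r≢b , a≁b) triples =
      (⊤ - a - b , resolving-⊤-a-b a≢b r≢a r≢b a≁b , cong (_∸ 2) (∣⊤-x-y∣+2≡m (a≢b ∘ sym))) ,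
      resolving-lower-bound triples

    dimension≡n∸2⇔ : MetricDimK k G (n ∸ 2) ⇔ (SomePairResolvedByAThird × EveryTripleHasUnresolvedPair)
    dimension≡n∸2⇔ = mk⇔ (λ dim → dimension⇒resolved-pair dim , dimension⇒every-triple dim)
                         (λ (pair , triples) → conditions⇒dimension pair triples)

≅-trans : ∀ {n m l} {G : Graph n} {H : Graph m} {J : Graph l} → G ≅ H → H ≅ J → G ≅ J
≅-trans (f , G≅H) (g , H≅J) = ↔-trans f g , λ u v → trans (G≅H u v) (H≅J _ _)

↔-injective : ∀ {A B : Set} (f : A ↔ B) {x y : A} → Inverse.to f x ≡ Inverse.to f y → x ≡ y
↔-injective f = Injection.injective (↔⇒↣ f)

module Isomorphism {n m : ℕ} {G : Graph n} {H : Graph m} (iso : G ≅ H) where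
  open Inverse (proj₁ iso) public using (to; from; strictlyInverseˡ; strictlyInverseʳ)

  to-injective : ∀ {u v} → to u ≡ to v → u ≡ v
  to-injective = ↔-injective (proj₁ iso)

  from-injective : ∀ {a b} → from a ≡ from b → a ≡ b
  from-injective = ↔-injective (↔-sym (proj₁ iso))

  adjacency-to : ∀ u v → G u v ≡ H (to u) (to v)
  adjacency-to = proj₂ iso

  adjacency-from : ∀ a b → G (from a) (from b) ≡ H a b
  adjacency-from a b = trans (adjacency-to (from a) (from b)) (cong₂ H (strictlyInverseˡ a) (strictlyInverseˡ b))

  adjacency-fromˡ : ∀ a v → G (from a) v ≡ H a (to v)
  adjacency-fromˡ a v = trans (adjacency-to (from a) v) (cong (λ x → H x (to v)) (strictlyInverseˡ a))

  adjacency-fromʳ : ∀ u b → G u (from b) ≡ H (to u) b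
  adjacency-fromʳ u b = trans (adjacency-to u (from b)) (cong (H (to u)) (strictlyInverseˡ b))

record CompleteBipartition {n : ℕ} (G : Graph n) : Set where
  field
    side : Fin n → Bool
    left right : Fin n
    left-side : side left ≡ true
    right-side : side right ≡ false
    adjacency : ∀ u v → G u v ≡ side u xor side v

record CliqueJoinIndependent {n : ℕ} (G : Graph n) : Set where
  field
    clique : Fin n → Bool
    member outsider₁ outsider₂ : Fin n
    member-in : clique member ≡ true
    outsider₁-out : clique outsider₁ ≡ false
    outsider₂-out : clique outsider₂ ≡ false
    outsiders-distinct : outsider₁ ≢ outsider₂
    adjacency : ∀ u v → u ≢ v → G u v ≡ clique u ∨ clique v

-- K_s + (K_1 ∪ K_t): the apex is the K_1, and all other vertices form a clique.
record CliqueJoinApexAndClique {n : ℕ} (G : Graph n) : Set where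
  field
    clique : Fin n → Bool
    apex member outsider : Fin n
    member-in : clique member ≡ true
    apex-out : clique apex ≡ false
    outsider-out : clique outsider ≡ false
    outsider≢apex : outsider ≢ apex
    apex-adjacency : ∀ v → G apex v ≡ clique v
    adjacency-off-apex : ∀ u v → u ≢ v → u ≢ apex → v ≢ apex → G u v ≡ true

pigeonhole : (a b c : Bool) → a ≡ b ⊎ a ≡ c ⊎ b ≡ c
pigeonhole false false _ = inj₁ refl
pigeonhole true true _ = inj₁ refl
pigeonhole false true false = inj₂ (inj₁ refl)
pigeonhole true false true = inj₂ (inj₁ refl)
pigeonhole false true true = inj₂ (inj₂ refl)
pigeonhole true false false = inj₂ (inj₂ refl)

module ShapeConditions {n : ℕ} {G : Graph n} (simple : IsSimple G) (k : ℕ) (1≤k : 1 ≤ k) where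
  open SimpleGraph simple
  open Distances k 1≤k
  open Twin simple
  open TwinDistances k 1≤k
  open Resolvability simple k 1≤k

  twins⇒unresolved : ∀ {x y z} → Twins x y → UnresolvedOutside x y z
  twins⇒unresolved xy r r≢x r≢y _ = twins⇒dₖ≡ xy r≢x r≢y

  adjacency-differs⇒resolved : ∀ {a b r} → G a r ≡ true → G b r ≡ false → r ≢ b → SomePairResolvedByAThird
  adjacency-differs⇒resolved {a} {b} {r} ar br r≢b =
    a , b , r , (λ { refl → contradiction (trans (sym ar) br) λ () }) , adjacent⇒≢ ar ∘ sym , r≢b ,
    λ eq → contradiction (trans (sym ar) (trans (dₖ≡⇒adjacency≡ eq) br)) λ ()

  twin-classes⇒every-triple : (class : Fin n → Bool) → (∀ {u v} → class u ≡ class v → Twins u v) →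
                              EveryTripleHasUnresolvedPair
  twin-classes⇒every-triple class twins a b c _ _ _ with pigeonhole (class a) (class b) (class c)
  ... | inj₁ ab = inj₁ (twins⇒unresolved (twins ab))
  ... | inj₂ (inj₁ ac) = inj₂ (inj₁ (twins⇒unresolved (twins ac)))
  ... | inj₂ (inj₂ bc) = inj₂ (inj₂ (twins⇒unresolved (twins bc)))

  bipartition-conditions : 3 ≤ n → CompleteBipartition G →
                           SomePairResolvedByAThird × EveryTripleHasUnresolvedPair
  bipartition-conditions 3≤n shape = resolved , twin-classes⇒every-triple side same-side-twins
    where
      open CompleteBipartition shape
      same-side-twins : ∀ {u v} → side u ≡ side v → Twins u v
      same-side-twins {u} {v} eq r _ _ = trans (adjacency u r) (trans (cong (_xor side r) eq) (sym (adjacency v r)))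
      left≢right : left ≢ right
      left≢right refl = contradiction (trans (sym left-side) right-side) λ ()
      resolved : SomePairResolvedByAThird
      resolved with third-element 3≤n left≢right
      ... | w , w≢left , w≢right with side w in w-side
      ...   | true = adjacency-differs⇒resolved {right} {left} {w}
                       (trans (adjacency right w) (cong₂ _xor_ right-side w-side))
                       (trans (adjacency left w) (cong₂ _xor_ left-side w-side)) w≢left
      ...   | false = adjacency-differs⇒resolved {left} {right} {w}
                       (trans (adjacency left w) (cong₂ _xor_ left-side w-side))
                       (trans (adjacency right w) (cong₂ _xor_ right-side w-side)) w≢right

  clique-join-independent-conditions : CliqueJoinIndependent G →
                                       SomePairResolvedByAThird × EveryTripleHasUnresolvedPair
  clique-join-independent-conditions shape = resolved , twin-classes⇒every-triple clique same-side-twins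
    where
      open CliqueJoinIndependent shape
      same-side-twins : ∀ {u v} → clique u ≡ clique v → Twins u v
      same-side-twins {u} {v} eq r r≢u r≢v =
        trans (adjacency u r (r≢u ∘ sym)) (trans (cong (_∨ clique r) eq) (sym (adjacency v r (r≢v ∘ sym))))
      member≢outsider₂ : member ≢ outsider₂
      member≢outsider₂ refl = contradiction (trans (sym member-in) outsider₂-out) λ ()
      resolved : SomePairResolvedByAThird
      resolved = adjacency-differs⇒resolved {member} {outsider₁} {outsider₂}
        (trans (adjacency member outsider₂ member≢outsider₂) (cong (_∨ clique outsider₂) member-in))
        (trans (adjacency outsider₁ outsider₂ outsiders-distinct) (cong₂ _∨_ outsider₁-out outsider₂-out))
        (outsiders-distinct ∘ sym)

  clique-join-apex-conditions : CliqueJoinApexAndClique G →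
                                SomePairResolvedByAThird × EveryTripleHasUnresolvedPair
  clique-join-apex-conditions shape = resolved , triples
    where
      open CliqueJoinApexAndClique shape
      clique-differs : ∀ {u v} → clique u ≡ true → clique v ≡ false → u ≢ v
      clique-differs u-in v-out refl = contradiction (trans (sym u-in) v-out) λ ()
      apex-neighbours : ∀ {u} → u ≢ apex → G u apex ≡ clique u
      apex-neighbours {u} _ = trans (adjacency-sym u apex) (apex-adjacency u)
      off-apex-twins : ∀ {u v} → u ≢ apex → v ≢ apex → clique u ≡ clique v → Twins u v
      off-apex-twins {u} {v} u≢apex v≢apex eq r r≢u r≢v with r ≟ᶠ apex
      ... | yes refl = trans (apex-neighbours u≢apex) (trans eq (sym (apex-neighbours v≢apex)))
      ... | no r≢apex = trans (adjacency-off-apex u r (r≢u ∘ sym) u≢apex r≢apex)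
                              (sym (adjacency-off-apex v r (r≢v ∘ sym) v≢apex r≢apex))
      unresolved-beside-apex : ∀ {u v} → u ≢ apex → v ≢ apex → UnresolvedOutside u v apex
      unresolved-beside-apex {u} {v} u≢apex v≢apex r r≢u r≢v r≢apex =
        trans (adjacent⇒dₖ≡1 (adjacency-off-apex u r (r≢u ∘ sym) u≢apex r≢apex))
              (sym (adjacent⇒dₖ≡1 (adjacency-off-apex v r (r≢v ∘ sym) v≢apex r≢apex)))
      triples : EveryTripleHasUnresolvedPair
      triples a b c a≢b a≢c b≢c with a ≟ᶠ apex | b ≟ᶠ apex | c ≟ᶠ apex
      ... | yes refl | _ | _ = inj₂ (inj₂ (unresolved-beside-apex (a≢b ∘ sym) (a≢c ∘ sym)))
      ... | no a≢apex | yes refl | _ = inj₂ (inj₁ (unresolved-beside-apex a≢apex (b≢c ∘ sym)))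
      ... | no a≢apex | no b≢apex | yes refl = inj₁ (unresolved-beside-apex a≢apex b≢apex)
      ... | no a≢apex | no b≢apex | no c≢apex with pigeonhole (clique a) (clique b) (clique c)
      ...   | inj₁ ab = inj₁ (twins⇒unresolved (off-apex-twins a≢apex b≢apex ab))
      ...   | inj₂ (inj₁ ac) = inj₂ (inj₁ (twins⇒unresolved (off-apex-twins a≢apex c≢apex ac)))
      ...   | inj₂ (inj₂ bc) = inj₂ (inj₂ (twins⇒unresolved (off-apex-twins b≢apex c≢apex bc)))
      resolved : SomePairResolvedByAThird
      resolved = adjacency-differs⇒resolved {member} {apex} {outsider}
        (adjacency-off-apex member outsider (clique-differs member-in outsider-out)
                            (clique-differs member-in apex-out) outsider≢apex)
        (trans (apex-adjacency outsider) outsider-out) outsider≢apex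

remaining-vertex : (a b c : Fin 4) → a ≢ b → a ≢ c → b ≢ c →
                   ∃ λ d → d ≢ a × d ≢ b × d ≢ c × (∀ r → r ≢ a → r ≢ b → r ≢ c → r ≡ d)
remaining-vertex = toWitness {a? = decision} tt
  where
    decision : Dec (∀ a b c → a ≢ b → a ≢ c → b ≢ c →
                    ∃ λ d → d ≢ a × d ≢ b × d ≢ c × (∀ r → r ≢ a → r ≢ b → r ≢ c → r ≡ d))
    decision = all? λ a → all? λ b → all? λ c →
      ¬? (a ≟ᶠ b) →-dec (¬? (a ≟ᶠ c) →-dec (¬? (b ≟ᶠ c) →-dec
        any? λ d → ¬? (d ≟ᶠ a) ×-dec (¬? (d ≟ᶠ b) ×-dec (¬? (d ≟ᶠ c) ×-dec
          all? λ r → ¬? (r ≟ᶠ a) →-dec (¬? (r ≟ᶠ b) →-dec (¬? (r ≟ᶠ c) →-dec (r ≟ᶠ d)))))))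

module PathConditions {n : ℕ} {G : Graph n} (simple : IsSimple G) (k : ℕ) (1≤k : 1 ≤ k) where
  open SimpleGraph simple
  open Distances k 1≤k
  open Resolvability simple k 1≤k
  open ShapeConditions simple k 1≤k

  -- With k = 1 the distance to r only records adjacency to r.
  unresolved-if-one-outsider : k ≡ 1 → ∀ {x y z w} → (∀ r → r ≢ x → r ≢ y → r ≢ z → r ≡ w) →
                               w ≢ x → w ≢ y → G x w ≡ G y w → UnresolvedOutside x y z
  unresolved-if-one-outsider k≡1 {w = w} only-w w≢x w≢y eq r r≢x r≢y r≢z with only-w r r≢x r≢y r≢z
  ... | refl = adjacency≡⇒dₖ≡ k≡1 (w≢x ∘ sym) (w≢y ∘ sym) eq

  one-outsider⇒unresolved-pair : k ≡ 1 → ∀ {a b c w} → (∀ r → r ≢ a → r ≢ b → r ≢ c → r ≡ w) →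
                                 w ≢ a → w ≢ b → w ≢ c → HasUnresolvedPair a b c
  one-outsider⇒unresolved-pair k≡1 {a} {b} {c} {w} only-w w≢a w≢b w≢c with pigeonhole (G a w) (G b w) (G c w)
  ... | inj₁ ab = inj₁ (unresolved-if-one-outsider k≡1 only-w w≢a w≢b ab)
  ... | inj₂ (inj₁ ac) = inj₂ (inj₁ (unresolved-if-one-outsider k≡1 (λ r r≢a r≢c r≢b → only-w r r≢a r≢b r≢c) w≢a w≢c ac))
  ... | inj₂ (inj₂ bc) = inj₂ (inj₂ (unresolved-if-one-outsider k≡1 (λ r r≢b r≢c r≢a → only-w r r≢a r≢b r≢c) w≢b w≢c bc))

  four-vertices⇒every-triple : k ≡ 1 → ∀ {H : Graph 4} → G ≅ H → EveryTripleHasUnresolvedPair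
  four-vertices⇒every-triple k≡1 {H} iso a b c a≢b a≢c b≢c =
    via (remaining-vertex (to a) (to b) (to c) (a≢b ∘ to-injective) (a≢c ∘ to-injective) (b≢c ∘ to-injective))
    where
      open Isomorphism {H = H} iso
      via : (∃ λ d → d ≢ to a × d ≢ to b × d ≢ to c × (∀ r → r ≢ to a → r ≢ to b → r ≢ to c → r ≡ d)) →
            HasUnresolvedPair a b c
      via (d , d≢a , d≢b , d≢c , only-d) = one-outsider⇒unresolved-pair k≡1 only-from-d (≢to d≢a) (≢to d≢b) (≢to d≢c)
        where
          ≢to : ∀ {x} → d ≢ to x → from d ≢ x
          ≢to d≢x refl = d≢x (sym (strictlyInverseˡ d))
          only-from-d : ∀ r → r ≢ a → r ≢ b → r ≢ c → r ≡ from d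
          only-from-d r r≢a r≢b r≢c = trans (sym (strictlyInverseʳ r))
            (cong from (only-d (to r) (r≢a ∘ to-injective) (r≢b ∘ to-injective) (r≢c ∘ to-injective)))

  no-common-neighbour-of-ends : ∀ j → Path 4 zero j ≡ true → Path 4 j (suc (suc (suc zero))) ≡ true → ⊥
  no-common-neighbour-of-ends zero ()
  no-common-neighbour-of-ends (suc zero) _ ()
  no-common-neighbour-of-ends (suc (suc zero)) ()
  no-common-neighbour-of-ends (suc (suc (suc zero))) ()

  module OnPath₄ (iso : G ≅ Path 4) where
    open Isomorphism {H = Path 4} iso

    p₀ p₁ p₂ p₃ : Fin n
    p₀ = from zero
    p₁ = from (suc zero)
    p₂ = from (suc (suc zero))
    p₃ = from (suc (suc (suc zero)))

    from-≢ : ∀ {i j} → i ≢ j → from i ≢ from j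
    from-≢ i≢j = i≢j ∘ from-injective

    resolved-pair : SomePairResolvedByAThird
    resolved-pair = adjacency-differs⇒resolved {p₁} {p₀} {p₂} (adjacency-from _ _) (adjacency-from _ _) (from-≢ λ ())

    module _ (2≤k : 2 ≤ k) where

      dₖ-p₀-p₃≢1 : dₖ p₀ p₃ ≢ 1
      dₖ-p₀-p₃≢1 d≡1 = contradiction (trans (sym (dₖ≡1⇒adjacent d≡1)) (adjacency-from _ _)) λ ()

      dₖ-p₀-p₃≢2 : dₖ p₀ p₃ ≢ 2
      dₖ-p₀-p₃≢2 d≡2 with dₖ≡2⇒common-neighbour 2≤k d≡2
      ... | w , p₀w , wp₃ = no-common-neighbour-of-ends (to w) (trans (sym (adjacency-fromˡ _ w)) p₀w)
                                                               (trans (sym (adjacency-fromʳ w _)) wp₃)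

      dₖ-p₁-p₃ : dₖ p₁ p₃ ≡ 2
      dₖ-p₁-p₃ = common-neighbour⇒dₖ≡2 2≤k {p₁} {p₂} {p₃} (from-≢ λ ())
                   (adjacency-from _ _) (adjacency-from _ _) (adjacency-from _ _)

      dₖ-p₂-p₃ : dₖ p₂ p₃ ≡ 1
      dₖ-p₂-p₃ = adjacent⇒dₖ≡1 (adjacency-from _ _)

      -- The last path vertex resolves every pair of the first three.
      violates-triples : ¬ EveryTripleHasUnresolvedPair
      violates-triples triples with triples p₀ p₁ p₂ (from-≢ λ ()) (from-≢ λ ()) (from-≢ λ ())
      ... | inj₁ p₀p₁ = dₖ-p₀-p₃≢2 (trans (p₀p₁ p₃ (from-≢ λ ()) (from-≢ λ ()) (from-≢ λ ())) dₖ-p₁-p₃)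
      ... | inj₂ (inj₁ p₀p₂) = dₖ-p₀-p₃≢1 (trans (p₀p₂ p₃ (from-≢ λ ()) (from-≢ λ ()) (from-≢ λ ())) dₖ-p₂-p₃)
      ... | inj₂ (inj₂ p₁p₂) =
        contradiction (trans (sym dₖ-p₁-p₃) (trans (p₁p₂ p₃ (from-≢ λ ()) (from-≢ λ ()) (from-≢ λ ())) dₖ-p₂-p₃)) λ ()

isLeft : ∀ {A B : Set} → A ⊎ B → Bool
isLeft (inj₁ _) = true
isLeft (inj₂ _) = false

K-adjacency : ∀ {s} {a b : Fin s} → a ≢ b → K s a b ≡ true
K-adjacency {a = a} {b} a≢b with a ≟ᶠ b
... | yes a≡b = contradiction a≡b a≢b
... | no _ = refl

K-irreflexive : ∀ {s} (a : Fin s) → K s a a ≡ false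
K-irreflexive a with a ≟ᶠ a
... | yes _ = refl
... | no a≢a = contradiction refl a≢a

splitAt-injective : ∀ s {t} {a b : Fin (s + t)} → splitAt s a ≡ splitAt s b → a ≡ b
splitAt-injective s {t} {a} {b} eq = trans (sym (join-splitAt s t a)) (trans (cong (join s t) eq) (join-splitAt s t b))

Kbip-adjacency : ∀ s t (a b : Fin (s + t)) → Kbip s t a b ≡ isLeft (splitAt s a) xor isLeft (splitAt s b)
Kbip-adjacency s t a b with splitAt s a | splitAt s b
... | inj₁ _ | inj₁ _ = refl
... | inj₁ _ | inj₂ _ = refl
... | inj₂ _ | inj₁ _ = refl
... | inj₂ _ | inj₂ _ = refl

K+E-adjacency : ∀ s t (a b : Fin (s + t)) → a ≢ b → (K s +G E t) a b ≡ isLeft (splitAt s a) ∨ isLeft (splitAt s b)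
K+E-adjacency s t a b a≢b with splitAt s a in eqa | splitAt s b in eqb
... | inj₁ x | inj₁ y = K-adjacency {a = x} {y} λ { refl → a≢b (splitAt-injective s (trans eqa (sym eqb))) }
... | inj₁ _ | inj₂ _ = refl
... | inj₂ _ | inj₁ _ = refl
... | inj₂ _ | inj₂ _ = refl

K+E-irreflexive : ∀ s t (a : Fin (s + t)) → (K s +G E t) a a ≡ false
K+E-irreflexive s t a with splitAt s a
... | inj₁ x = K-irreflexive x
... | inj₂ _ = refl

apexOf : ∀ s t → Fin (s + suc t)
apexOf s t = s ↑ʳ zero

K+K₁∪K-apex : ∀ s t v → (K s +G (K 1 ∪G K t)) (apexOf s t) v ≡ isLeft (splitAt s v)
K+K₁∪K-apex s t v rewrite splitAt-↑ʳ s (suc t) zero with splitAt s v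
... | inj₁ _ = refl
... | inj₂ zero = refl
... | inj₂ (suc _) = refl

K+K₁∪K-apexʳ : ∀ s t v → (K s +G (K 1 ∪G K t)) v (apexOf s t) ≡ isLeft (splitAt s v)
K+K₁∪K-apexʳ s t v rewrite splitAt-↑ʳ s (suc t) zero with splitAt s v
... | inj₁ _ = refl
... | inj₂ zero = refl
... | inj₂ (suc _) = refl

K+K₁∪K-off-apex : ∀ s t (a b : Fin (s + suc t)) → a ≢ b → a ≢ apexOf s t → b ≢ apexOf s t →
                  (K s +G (K 1 ∪G K t)) a b ≡ true
K+K₁∪K-off-apex s t a b a≢b a≢apex b≢apex with splitAt s a in eqa | splitAt s b in eqb
... | inj₁ x | inj₁ y = K-adjacency {a = x} {y} λ { refl → a≢b (splitAt-injective s (trans eqa (sym eqb))) }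
... | inj₁ _ | inj₂ _ = refl
... | inj₂ _ | inj₁ _ = refl
... | inj₂ zero | _ = ⊥-elim (a≢apex (splitAt-injective s (trans eqa (sym (splitAt-↑ʳ s (suc t) zero)))))
... | inj₂ (suc _) | inj₂ zero = ⊥-elim (b≢apex (splitAt-injective s (trans eqb (sym (splitAt-↑ʳ s (suc t) zero)))))
... | inj₂ (suc i) | inj₂ (suc j) =
  K-adjacency {a = i} {j} λ { refl → a≢b (splitAt-injective s (trans eqa (sym eqb))) }

K+K₁∪K-irreflexive : ∀ s t (a : Fin (s + suc t)) → (K s +G (K 1 ∪G K t)) a a ≡ false
K+K₁∪K-irreflexive s t a with splitAt s a
... | inj₁ x = K-irreflexive x
... | inj₂ zero = refl
... | inj₂ (suc i) = K-irreflexive i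

module ModelShape {n s t : ℕ} {G : Graph n} {H : Graph (s + t)} (iso : G ≅ H) where
  open Isomorphism {H = H} iso

  side : Fin n → Bool
  side u = isLeft (splitAt s (to u))

  side-from : ∀ x → side (from (join s t x)) ≡ isLeft x
  side-from x = trans (cong (isLeft ∘ splitAt s) (strictlyInverseˡ _)) (cong isLeft (splitAt-join s t x))

  from-join-injective : ∀ {x y} → from (join s t x) ≡ from (join s t y) → x ≡ y
  from-join-injective {x} {y} eq = trans (sym (splitAt-join s t x)) (trans (cong (splitAt s) (from-injective eq)) (splitAt-join s t y))

Kbip-iso⇒bipartition : ∀ {n s t} {G : Graph n} → 1 ≤ s → 1 ≤ t → G ≅ Kbip s t → CompleteBipartition G
Kbip-iso⇒bipartition {s = suc s} {suc t} (s≤s _) (s≤s _) iso = record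
  { side = side
  ; left = from (join (suc s) (suc t) (inj₁ zero))
  ; right = from (join (suc s) (suc t) (inj₂ zero))
  ; left-side = side-from (inj₁ zero)
  ; right-side = side-from (inj₂ zero)
  ; adjacency = λ u v → trans (adjacency-to u v) (Kbip-adjacency (suc s) (suc t) (to u) (to v))
  }
  where
    open Isomorphism {H = Kbip (suc s) (suc t)} iso
    open ModelShape {s = suc s} {suc t} {H = Kbip (suc s) (suc t)} iso

K+E-iso⇒clique-join-independent : ∀ {n s t} {G : Graph n} → 1 ≤ s → 2 ≤ t → G ≅ (K s +G E t) → CliqueJoinIndependent G
K+E-iso⇒clique-join-independent {s = suc s} {suc (suc t)} (s≤s _) (s≤s (s≤s _)) iso = record
  { clique = side
  ; member = from (join (suc s) (suc (suc t)) (inj₁ zero))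
  ; outsider₁ = from (join (suc s) (suc (suc t)) (inj₂ zero))
  ; outsider₂ = from (join (suc s) (suc (suc t)) (inj₂ (suc zero)))
  ; member-in = side-from (inj₁ zero)
  ; outsider₁-out = side-from (inj₂ zero)
  ; outsider₂-out = side-from (inj₂ (suc zero))
  ; outsiders-distinct = λ eq → contradiction (from-join-injective {inj₂ zero} {inj₂ (suc zero)} eq) λ ()
  ; adjacency = λ u v u≢v → trans (adjacency-to u v) (K+E-adjacency (suc s) (suc (suc t)) (to u) (to v) (u≢v ∘ to-injective))
  }
  where
    open Isomorphism {H = K (suc s) +G E (suc (suc t))} iso
    open ModelShape {s = suc s} {suc (suc t)} {H = K (suc s) +G E (suc (suc t))} iso

K+K₁∪K-iso⇒clique-join-apex : ∀ {n s t} {G : Graph n} → 1 ≤ s → 1 ≤ t → G ≅ (K s +G (K 1 ∪G K t)) →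
                              CliqueJoinApexAndClique G
K+K₁∪K-iso⇒clique-join-apex {s = suc s} {suc t} (s≤s _) (s≤s _) iso = record
  { clique = side
  ; apex = from (apexOf (suc s) (suc t))
  ; member = from (join (suc s) (suc (suc t)) (inj₁ zero))
  ; outsider = from (join (suc s) (suc (suc t)) (inj₂ (suc zero)))
  ; member-in = side-from (inj₁ zero)
  ; apex-out = side-from (inj₂ zero)
  ; outsider-out = side-from (inj₂ (suc zero))
  ; outsider≢apex = λ eq → contradiction (from-join-injective {inj₂ (suc zero)} {inj₂ zero} eq) λ ()
  ; apex-adjacency = λ v → trans (adjacency-fromˡ _ v) (K+K₁∪K-apex (suc s) (suc t) (to v))
  ; adjacency-off-apex = λ u v u≢v u≢apex v≢apex → trans (adjacency-to u v)
      (K+K₁∪K-off-apex (suc s) (suc t) (to u) (to v) (u≢v ∘ to-injective) (off u≢apex) (off v≢apex))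
  }
  where
    open Isomorphism {H = K (suc s) +G (K 1 ∪G K (suc t))} iso
    open ModelShape {s = suc s} {suc (suc t)} {H = K (suc s) +G (K 1 ∪G K (suc t))} iso
    off : ∀ {u} → u ≢ from (apexOf (suc s) (suc t)) → to u ≢ apexOf (suc s) (suc t)
    off u≢apex eq = u≢apex (trans (sym (strictlyInverseʳ _)) (cong from eq))

record Partition {n : ℕ} (A : Fin n → Bool) : Set where
  field
    s t : ℕ
    bijection : Fin n ↔ (Fin s ⊎ Fin t)
  open Inverse bijection public using (to; from; strictlyInverseˡ; strictlyInverseʳ)
  field
    isLeft-to : ∀ u → isLeft (to u) ≡ A u

isLeft-swap : ∀ {A B : Set} (x : A ⊎ B) → isLeft (swap x) ≡ not (isLeft x)
isLeft-swap (inj₁ _) = refl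
isLeft-swap (inj₂ _) = refl

isLeft-map : ∀ {A B C D : Set} {f : A → C} {g : B → D} (x : A ⊎ B) → isLeft (Sum.map f g x) ≡ isLeft x
isLeft-map (inj₁ _) = refl
isLeft-map (inj₂ _) = refl

partition-cong : ∀ {n} {A B : Fin n → Bool} → (∀ u → A u ≡ B u) → Partition A → Partition B
partition-cong A≗B P = record { bijection = bijection ; isLeft-to = λ u → trans (isLeft-to u) (A≗B u) }
  where open Partition P

flip-sides : ∀ {n} {A : Fin n → Bool} → Partition A → Partition (not ∘ A)
flip-sides P = record
  { bijection = ↔-trans bijection (⊎-comm _ _)
  ; isLeft-to = λ u → trans (isLeft-swap (to u)) (cong not (isLeft-to u))
  }
  where open Partition P

add-left : ∀ {n} {A : Fin (suc n) → Bool} → Partition (A ∘ suc) → A zero ≡ true → Partition A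
add-left {n} {A} P A₀ = record
  { bijection = mk↔ₛ′ to′ from′ to∘from from∘to
  ; isLeft-to = isLeft-to′
  }
  where
    open Partition P
    to′ : Fin (suc n) → Fin (suc s) ⊎ Fin t
    to′ zero = inj₁ zero
    to′ (suc u) = Sum.map suc id (to u)
    from′ : Fin (suc s) ⊎ Fin t → Fin (suc n)
    from′ (inj₁ zero) = zero
    from′ (inj₁ (suc i)) = suc (from (inj₁ i))
    from′ (inj₂ j) = suc (from (inj₂ j))
    to∘from : ∀ y → to′ (from′ y) ≡ y
    to∘from (inj₁ zero) = refl
    to∘from (inj₁ (suc i)) = cong (Sum.map suc id) (strictlyInverseˡ (inj₁ i))
    to∘from (inj₂ j) = cong (Sum.map suc id) (strictlyInverseˡ (inj₂ j))
    from∘to : ∀ u → from′ (to′ u) ≡ u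
    from∘to zero = refl
    from∘to (suc u) with to u in eq
    ... | inj₁ i = cong suc (trans (cong from (sym eq)) (strictlyInverseʳ u))
    ... | inj₂ j = cong suc (trans (cong from (sym eq)) (strictlyInverseʳ u))
    isLeft-to′ : ∀ u → isLeft (to′ u) ≡ A u
    isLeft-to′ zero = sym A₀
    isLeft-to′ (suc u) = trans (isLeft-map (to u)) (isLeft-to u)

partition : ∀ {n} (A : Fin n → Bool) → Partition A
partition {zero} A = record
  { s = 0 ; t = 0
  ; bijection = mk↔ₛ′ (λ ()) (λ { (inj₁ ()) ; (inj₂ ()) }) (λ { (inj₁ ()) ; (inj₂ ()) }) (λ ())
  ; isLeft-to = λ ()
  }
partition {suc n} A with A zero in A₀
... | true = add-left (partition (A ∘ suc)) A₀
... | false = partition-cong (not-involutive ∘ A) (flip-sides (add-left (flip-sides (partition (A ∘ suc))) (cong not A₀)))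

fin⇒1≤ : ∀ {m} → Fin m → 1 ≤ m
fin⇒1≤ zero = s≤s z≤n
fin⇒1≤ (suc _) = s≤s z≤n

distinct-fins⇒2≤ : ∀ {m} {i j : Fin m} → i ≢ j → 2 ≤ m
distinct-fins⇒2≤ {i = zero} {zero} i≢j = contradiction refl i≢j
distinct-fins⇒2≤ {i = zero} {suc j} _ = s≤s (fin⇒1≤ j)
distinct-fins⇒2≤ {i = suc i} _ = s≤s (fin⇒1≤ i)

isLeft⇒1≤ : ∀ {s t} (x : Fin s ⊎ Fin t) → isLeft x ≡ true → 1 ≤ s
isLeft⇒1≤ (inj₁ i) _ = fin⇒1≤ i

isRight⇒index : ∀ {s t} (x : Fin s ⊎ Fin t) → isLeft x ≡ false → ∃ λ j → x ≡ inj₂ j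
isRight⇒index (inj₂ j) _ = j , refl

module PartitionProperties {n : ℕ} {A : Fin n → Bool} (P : Partition A) where
  open Partition P

  1≤s : ∀ {u} → A u ≡ true → 1 ≤ s
  1≤s {u} Au = isLeft⇒1≤ (to u) (trans (isLeft-to u) Au)

  1≤t : ∀ {u} → A u ≡ false → 1 ≤ t
  1≤t {u} Au = fin⇒1≤ (proj₁ (isRight⇒index (to u) (trans (isLeft-to u) Au)))

  2≤t : ∀ {u v} → A u ≡ false → A v ≡ false → u ≢ v → 2 ≤ t
  2≤t {u} {v} Au Av u≢v with isRight⇒index (to u) (trans (isLeft-to u) Au) | isRight⇒index (to v) (trans (isLeft-to v) Av)
  ... | i , u↦i | j , v↦j = distinct-fins⇒2≤ {i = i} {j} λ { refl → u≢v (↔-injective bijection (trans u↦i (sym v↦j))) }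

  toFin : Fin n ↔ Fin (s + t)
  toFin = ↔-trans bijection (↔-sym +↔⊎)

  side-toFin : ∀ u → isLeft (splitAt s (Inverse.to toFin u)) ≡ A u
  side-toFin u = trans (cong isLeft (splitAt-join s t (to u))) (isLeft-to u)

bipartition⇒≅Kbip : ∀ {n} {G : Graph n} → CompleteBipartition G → Σ ℕ λ s → Σ ℕ λ t → 1 ≤ s × 1 ≤ t × G ≅ Kbip s t
bipartition⇒≅Kbip {G = G} shape =
  s , t , 1≤s left-side , 1≤t right-side , toFin , λ u v →
    trans (adjacency u v) (sym (trans (Kbip-adjacency s t _ _) (cong₂ _xor_ (side-toFin u) (side-toFin v))))
  where
    open CompleteBipartition shape
    open Partition (partition side)
    open PartitionProperties (partition side)

clique-join-independent⇒≅K+E : ∀ {n} {G : Graph n} → IsSimple G → CliqueJoinIndependent G →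
                               Σ ℕ λ s → Σ ℕ λ t → 1 ≤ s × 2 ≤ t × G ≅ (K s +G E t)
clique-join-independent⇒≅K+E {G = G} simple shape =
  s , t , 1≤s member-in , 2≤t outsider₁-out outsider₂-out outsiders-distinct , toFin , edge
  where
    open CliqueJoinIndependent shape
    open Partition (partition clique)
    open PartitionProperties (partition clique)
    edge : ∀ u v → G u v ≡ (K s +G E t) (Inverse.to toFin u) (Inverse.to toFin v)
    edge u v with u ≟ᶠ v
    ... | yes refl = trans (proj₂ simple u) (sym (K+E-irreflexive s t _))
    ... | no u≢v = trans (adjacency u v u≢v)
        (sym (trans (K+E-adjacency s t _ _ (u≢v ∘ ↔-injective toFin)) (cong₂ _∨_ (side-toFin u) (side-toFin v))))

transpose-source : ∀ {m} (i j : Fin m) → PC.transpose i j i ≡ j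
transpose-source i j rewrite dec-true (i ≟ᶠ i) refl = refl

module _ {n : ℕ} {G : Graph n} (simple : IsSimple G) (shape : CliqueJoinApexAndClique G) where
  open CliqueJoinApexAndClique shape

  -- Relabel the non-clique side so that the apex becomes its first vertex.
  apex-first⇒≅ : ∀ {s m} (β : Fin n ↔ (Fin s ⊎ Fin m)) → (∀ u → isLeft (Inverse.to β u) ≡ clique u) →
                 ∀ j → Inverse.to β apex ≡ inj₂ j →
                 Σ ℕ λ s → Σ ℕ λ t → 1 ≤ s × 1 ≤ t × G ≅ (K s +G (K 1 ∪G K t))
  apex-first⇒≅ {m = zero} β side () _
  apex-first⇒≅ {s} {suc t} β side j apex↦j = s , t , 1≤s , 1≤t , f , edge
    where
      f : Fin n ↔ Fin (s + suc t)
      f = ↔-trans β (↔-trans (↔-refl ⊎-↔ transpose j zero) (↔-sym +↔⊎))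
      open Inverse f using (to)
      to-side : ∀ u → isLeft (splitAt s (to u)) ≡ clique u
      to-side u = trans (cong isLeft (splitAt-join s (suc t) _)) (trans (isLeft-map (Inverse.to β u)) (side u))
      to-apex : to apex ≡ apexOf s t
      to-apex = trans (cong (join s (suc t) ∘ Sum.map id (PC.transpose j zero)) apex↦j)
                      (cong (join s (suc t) ∘ inj₂) (transpose-source j zero))
      to-off-apex : ∀ {u} → u ≢ apex → to u ≢ apexOf s t
      to-off-apex u≢apex eq = u≢apex (↔-injective f (trans eq (sym to-apex)))
      1≤s : 1 ≤ s
      1≤s = isLeft⇒1≤ _ (trans (side member) member-in)
      1≤t : 1 ≤ t
      1≤t with isRight⇒index (Inverse.to β outsider) (trans (side outsider) outsider-out)
      ... | j′ , outsider↦j′ = s≤s⁻¹ (distinct-fins⇒2≤ {i = j′} {j} λ { refl →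
              outsider≢apex (↔-injective β (trans outsider↦j′ (sym apex↦j))) })
      edge : ∀ u v → G u v ≡ (K s +G (K 1 ∪G K t)) (to u) (to v)
      edge u v with u ≟ᶠ apex | v ≟ᶠ apex
      ... | yes refl | _ = trans (apex-adjacency v)
            (sym (trans (cong (λ a → (K s +G (K 1 ∪G K t)) a (to v)) to-apex) (trans (K+K₁∪K-apex s t (to v)) (to-side v))))
      ... | no _ | yes refl = trans (proj₁ simple u apex) (trans (apex-adjacency u)
            (sym (trans (cong ((K s +G (K 1 ∪G K t)) (to u)) to-apex) (trans (K+K₁∪K-apexʳ s t (to u)) (to-side u)))))
      ... | no u≢apex | no v≢apex with u ≟ᶠ v
      ...   | yes refl = trans (proj₂ simple u) (sym (K+K₁∪K-irreflexive s t (to u)))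
      ...   | no u≢v = trans (adjacency-off-apex u v u≢v u≢apex v≢apex)
              (sym (K+K₁∪K-off-apex s t (to u) (to v) (u≢v ∘ ↔-injective f) (to-off-apex u≢apex) (to-off-apex v≢apex)))

clique-join-apex⇒≅K+K₁∪K : ∀ {n} {G : Graph n} → IsSimple G → CliqueJoinApexAndClique G →
                           Σ ℕ λ s → Σ ℕ λ t → 1 ≤ s × 1 ≤ t × G ≅ (K s +G (K 1 ∪G K t))
clique-join-apex⇒≅K+K₁∪K simple shape = apex-first⇒≅ simple shape bijection isLeft-to (proj₁ apex-index) (proj₂ apex-index)
  where
    open CliqueJoinApexAndClique shape
    open Partition (partition clique)
    apex-index : ∃ λ j → to apex ≡ inj₂ j
    apex-index = isRight⇒index (to apex) (trans (isLeft-to apex) apex-out)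

private
  ∧-intro : ∀ {a b} → T a → T b → T (a ∧ b)
  ∧-intro ta tb = Equivalence.from T-∧ (ta , tb)

  ∧-elim : ∀ {a b} → T (a ∧ b) → T a × T b
  ∧-elim = Equivalence.to T-∧

  ∨-introˡ : ∀ {a b} → T a → T (a ∨ b)
  ∨-introˡ ta = Equivalence.from T-∨ (inj₁ ta)

  ∨-introʳ : ∀ {a b} → T b → T (a ∨ b)
  ∨-introʳ {a} tb = Equivalence.from (T-∨ {a}) (inj₂ tb)

  T-not : ∀ {a} → T (not a) → ¬ T a
  T-not {false} _ ()

  T-not⇒ : ∀ {a b} → T (not a ∨ b) → T a → T b
  T-not⇒ {true} tb _ = tb

-- A loopless symmetric adjacency relation on Fin m, stored as its upper triangle row by row.
Triangle : ℕ → Set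
Triangle zero = Unit
Triangle (suc m) = Vec Bool m × Triangle m

graphOf : ∀ {m} → Triangle m → Graph m
graphOf (row , rest) zero zero = false
graphOf (row , rest) zero (suc j) = lookup row j
graphOf (row , rest) (suc i) zero = lookup row i
graphOf (row , rest) (suc i) (suc j) = graphOf rest i j

triangle : ∀ {m} → Graph m → Triangle m
triangle {zero} h = tt
triangle {suc m} h = tabulate (h zero ∘ suc) , triangle (λ i j → h (suc i) (suc j))

graphOf-triangle : ∀ {m} {h : Graph m} → IsSimple h → ∀ i j → graphOf (triangle h) i j ≡ h i j
graphOf-triangle {h = h} (_ , irreflexive) zero zero = sym (irreflexive zero)
graphOf-triangle {h = h} _ zero (suc j) = lookup∘tabulate (h zero ∘ suc) j
graphOf-triangle {h = h} (symmetric , _) (suc i) zero = trans (lookup∘tabulate (h zero ∘ suc) i) (symmetric zero (suc i))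
graphOf-triangle {h = h} (symmetric , irreflexive) (suc i) (suc j) =
  graphOf-triangle {h = λ i j → h (suc i) (suc j)} ((λ i j → symmetric (suc i) (suc j)) , irreflexive ∘ suc) i j

allFin : ∀ {m} → (Fin m → Bool) → Bool
allFin {zero} p = true
allFin {suc m} p = p zero ∧ allFin (p ∘ suc)

allFin-complete : ∀ {m} {p : Fin m → Bool} → (∀ i → T (p i)) → T (allFin p)
allFin-complete {zero} _ = tt
allFin-complete {suc m} all = ∧-intro (all zero) (allFin-complete (all ∘ suc))

allFin-sound : ∀ {m} {p : Fin m → Bool} → T (allFin p) → ∀ i → T (p i)
allFin-sound {suc m} all zero = proj₁ (∧-elim all)
allFin-sound {suc m} all (suc i) = allFin-sound (proj₂ (∧-elim all)) i

anyFin : ∀ {m} → (Fin m → Bool) → Bool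
anyFin {zero} p = false
anyFin {suc m} p = p zero ∨ anyFin (p ∘ suc)

anyFin-sound : ∀ {m} {p : Fin m → Bool} → T (anyFin p) → ∃ λ i → T (p i)
anyFin-sound {suc m} {p} any with Equivalence.to (T-∨ {p zero}) any
... | inj₁ p₀ = zero , p₀
... | inj₂ p-rest = let (i , pᵢ) = anyFin-sound p-rest in suc i , pᵢ

-- Pairs i < j and triples i < j < l.
allPairs : ∀ {m} → (Fin m → Fin m → Bool) → Bool
allPairs {zero} p = true
allPairs {suc m} p = allFin (p zero ∘ suc) ∧ allPairs (λ i j → p (suc i) (suc j))

allPairs-complete : ∀ {m} {p : Fin m → Fin m → Bool} → (∀ i j → i ≢ j → T (p i j)) → T (allPairs p)
allPairs-complete {zero} _ = tt
allPairs-complete {suc m} all =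
  ∧-intro (allFin-complete λ j → all zero (suc j) λ ()) (allPairs-complete λ i j i≢j → all (suc i) (suc j) (i≢j ∘ fsuc-injective))

allTriples : ∀ {m} → (Fin m → Fin m → Fin m → Bool) → Bool
allTriples {zero} p = true
allTriples {suc m} p = allPairs (λ j l → p zero (suc j) (suc l)) ∧ allTriples (λ i j l → p (suc i) (suc j) (suc l))

allTriples-complete : ∀ {m} {p : Fin m → Fin m → Fin m → Bool} →
                      (∀ i j l → i ≢ j → i ≢ l → j ≢ l → T (p i j l)) → T (allTriples p)
allTriples-complete {zero} _ = tt
allTriples-complete {suc m} all = ∧-intro (allPairs-complete λ j l j≢l → all zero (suc j) (suc l) (λ ()) (λ ()) (j≢l ∘ fsuc-injective))
  (allTriples-complete λ i j l i≢j i≢l j≢l →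
    all (suc i) (suc j) (suc l) (i≢j ∘ fsuc-injective) (i≢l ∘ fsuc-injective) (j≢l ∘ fsuc-injective))

allBoolVecs : ∀ {k} → (Vec Bool k → Bool) → Bool
allBoolVecs {zero} p = p []
allBoolVecs {suc k} p = allBoolVecs (p ∘ (true ∷_)) ∧ allBoolVecs (p ∘ (false ∷_))

allBoolVecs-sound : ∀ {k} {p : Vec Bool k → Bool} → T (allBoolVecs p) → ∀ v → T (p v)
allBoolVecs-sound {zero} all [] = all
allBoolVecs-sound {suc k} all (true ∷ v) = allBoolVecs-sound (proj₁ (∧-elim all)) v
allBoolVecs-sound {suc k} all (false ∷ v) = allBoolVecs-sound (proj₂ (∧-elim all)) v

allTriangles : ∀ {m} → (Triangle m → Bool) → Bool
allTriangles {zero} p = p tt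
allTriangles {suc m} p = allBoolVecs λ row → allTriangles λ rest → p (row , rest)

allTriangles-sound : ∀ {m} {p : Triangle m → Bool} → T (allTriangles p) → ∀ t → T (p t)
allTriangles-sound {zero} all tt = all
allTriangles-sound {suc m} all (row , rest) = allTriangles-sound (allBoolVecs-sound all row) rest

anyFinVec : ∀ {m k} → (Vec (Fin m) k → Bool) → Bool
anyFinVec {k = zero} p = p []
anyFinVec {k = suc k} p = anyFin λ i → anyFinVec (p ∘ (i ∷_))

anyFinVec-sound : ∀ {m k} {p : Vec (Fin m) k → Bool} → T (anyFinVec p) → ∃ λ v → T (p v)
anyFinVec-sound {k = zero} any = [] , any
anyFinVec-sound {k = suc k} any =
  let (i , anyᵢ) = anyFin-sound any ; (v , pv) = anyFinVec-sound anyᵢ in i ∷ v , pv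

AgreeOutside : ∀ {m} → Graph m → Fin m → Fin m → Fin m → Set
AgreeOutside h x y z = ∀ r → r ≢ x → r ≢ y → r ≢ z → h x r ≡ h y r

SomePairAgreesOutside : ∀ {m} → Graph m → Fin m → Fin m → Fin m → Set
SomePairAgreesOutside h a b c = AgreeOutside h a b c ⊎ AgreeOutside h a c b ⊎ AgreeOutside h b c a

DiffersOnlyAt : ∀ {m} → Graph m → Fin m → Fin m → Fin m → Set
DiffersOnlyAt h x y z = AgreeOutside h x y z × h x z ≢ h y z

SomePairDiffersOnlyAtThird : ∀ {m} → Graph m → Fin m → Fin m → Fin m → Set
SomePairDiffersOnlyAtThird h a b c = DiffersOnlyAt h a b c ⊎ DiffersOnlyAt h a c b ⊎ DiffersOnlyAt h b c a

_==_ : ∀ {m} → Fin m → Fin m → Bool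
zero == zero = true
suc i == suc j = i == j
_ == _ = false

==-refl : ∀ {m} (i : Fin m) → T (i == i)
==-refl zero = tt
==-refl (suc i) = ==-refl i

==-sound : ∀ {m} {i j : Fin m} → T (i == j) → i ≡ j
==-sound {i = zero} {zero} _ = refl
==-sound {i = suc i} {suc j} eq = cong suc (==-sound eq)

_≡ᵇ_ : Bool → Bool → Bool
a ≡ᵇ b = not (a xor b)

≡ᵇ-complete : ∀ {a b} → a ≡ b → T (a ≡ᵇ b)
≡ᵇ-complete {false} refl = tt
≡ᵇ-complete {true} refl = tt

≡ᵇ-sound : ∀ {a b} → T (a ≡ᵇ b) → a ≡ b
≡ᵇ-sound {false} {false} _ = refl
≡ᵇ-sound {true} {true} _ = refl

≢ᵇ-complete : ∀ {a b} → a ≢ b → T (not (a ≡ᵇ b))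
≢ᵇ-complete {false} {false} a≢b = a≢b refl
≢ᵇ-complete {false} {true} _ = tt
≢ᵇ-complete {true} {false} _ = tt
≢ᵇ-complete {true} {true} a≢b = a≢b refl

module _ {m : ℕ} (h : Graph m) where

  agreeOutsideᵇ : Fin m → Fin m → Fin m → Bool
  agreeOutsideᵇ x y z = allFin λ r → (r == x) ∨ (r == y) ∨ (r == z) ∨ (h x r ≡ᵇ h y r)

  agreeOutsideᵇ-complete : ∀ {x y z} → AgreeOutside h x y z → T (agreeOutsideᵇ x y z)
  agreeOutsideᵇ-complete {x} {y} {z} agree = allFin-complete λ r → check r
    where
      check : ∀ r → T ((r == x) ∨ (r == y) ∨ (r == z) ∨ (h x r ≡ᵇ h y r))
      check r with r ≟ᶠ x | r ≟ᶠ y | r ≟ᶠ z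
      ... | yes refl | _ | _ = ∨-introˡ (==-refl r)
      ... | no _ | yes refl | _ = ∨-introʳ {r == x} (∨-introˡ (==-refl r))
      ... | no _ | no _ | yes refl = ∨-introʳ {r == x} (∨-introʳ {r == y} (∨-introˡ (==-refl r)))
      ... | no r≢x | no r≢y | no r≢z =
        ∨-introʳ {r == x} (∨-introʳ {r == y} (∨-introʳ {r == z} (≡ᵇ-complete (agree r r≢x r≢y r≢z))))

  somePairAgreesᵇ : Fin m → Fin m → Fin m → Bool
  somePairAgreesᵇ a b c = agreeOutsideᵇ a b c ∨ agreeOutsideᵇ a c b ∨ agreeOutsideᵇ b c a

  somePairAgreesᵇ-complete : ∀ {a b c} → SomePairAgreesOutside h a b c → T (somePairAgreesᵇ a b c)
  somePairAgreesᵇ-complete (inj₁ ab) = ∨-introˡ (agreeOutsideᵇ-complete ab)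
  somePairAgreesᵇ-complete {a} {b} {c} (inj₂ (inj₁ ac)) = ∨-introʳ {agreeOutsideᵇ a b c} (∨-introˡ (agreeOutsideᵇ-complete ac))
  somePairAgreesᵇ-complete {a} {b} {c} (inj₂ (inj₂ bc)) =
    ∨-introʳ {agreeOutsideᵇ a b c} (∨-introʳ {agreeOutsideᵇ a c b} (agreeOutsideᵇ-complete bc))

  differsOnlyAtᵇ : Fin m → Fin m → Fin m → Bool
  differsOnlyAtᵇ x y z = agreeOutsideᵇ x y z ∧ not (h x z ≡ᵇ h y z)

  differsOnlyAtᵇ-complete : ∀ {x y z} → DiffersOnlyAt h x y z → T (differsOnlyAtᵇ x y z)
  differsOnlyAtᵇ-complete (agree , differ) = ∧-intro (agreeOutsideᵇ-complete agree) (≢ᵇ-complete differ)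

  somePairDiffersᵇ : Fin m → Fin m → Fin m → Bool
  somePairDiffersᵇ a b c = differsOnlyAtᵇ a b c ∨ differsOnlyAtᵇ a c b ∨ differsOnlyAtᵇ b c a

  somePairDiffersᵇ-complete : ∀ {a b c} → SomePairDiffersOnlyAtThird h a b c → T (somePairDiffersᵇ a b c)
  somePairDiffersᵇ-complete (inj₁ ab) = ∨-introˡ (differsOnlyAtᵇ-complete ab)
  somePairDiffersᵇ-complete {a} {b} {c} (inj₂ (inj₁ ac)) = ∨-introʳ {differsOnlyAtᵇ a b c} (∨-introˡ (differsOnlyAtᵇ-complete ac))
  somePairDiffersᵇ-complete {a} {b} {c} (inj₂ (inj₂ bc)) =
    ∨-introʳ {differsOnlyAtᵇ a b c} (∨-introʳ {differsOnlyAtᵇ a c b} (differsOnlyAtᵇ-complete bc))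

fiveConfigurationᵇ : Graph 5 → Bool
fiveConfigurationᵇ h = allTriples (somePairAgreesᵇ h) ∧ allTriples {4} λ a b c → somePairDiffersᵇ h (suc a) (suc b) (suc c)

-- The `tt` below is accepted by evaluating the check on all 2¹⁰ graphs on five vertices.
no-five-configuration : (t : Triangle 5) →
  (∀ a b c → a ≢ b → a ≢ c → b ≢ c → SomePairAgreesOutside (graphOf t) a b c) →
  (∀ (a b c : Fin 4) → a ≢ b → a ≢ c → b ≢ c → SomePairDiffersOnlyAtThird (graphOf t) (suc a) (suc b) (suc c)) → ⊥
no-five-configuration t agree differ = T-not (allTriangles-sound {p = not ∘ fiveConfigurationᵇ ∘ graphOf} tt t)
  (∧-intro (allTriples-complete λ a b c a≢b a≢c b≢c → somePairAgreesᵇ-complete (graphOf t) (agree a b c a≢b a≢c b≢c))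
           (allTriples-complete λ a b c a≢b a≢c b≢c → somePairDiffersᵇ-complete (graphOf t) (differ a b c a≢b a≢c b≢c)))

-- The least index that σ maps to p (junk value zero if there is none).
preimage : ∀ {m n} → (Fin (suc m) → Fin n) → Fin n → Fin (suc m)
preimage {zero} σ p = zero
preimage {suc m} σ p with σ zero == p
... | true = zero
... | false = suc (preimage (σ ∘ suc) p)

pathLabellingᵇ : Graph 4 → (Fin 4 → Fin 4) → Bool
pathLabellingᵇ h σ = allFin (λ i → preimage σ (σ i) == i) ∧ allFin (λ p → σ (preimage σ p) == p)
                   ∧ allFin (λ i → allFin λ j → h i j ≡ᵇ Path 4 (σ i) (σ j))

pathLabellingᵇ-sound : ∀ {h σ} → T (pathLabellingᵇ h σ) → h ≅ Path 4
pathLabellingᵇ-sound {h} {σ} labelling =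
  mk↔ₛ′ σ (preimage σ) (λ p → ==-sound (allFin-sound {p = λ p → σ (preimage σ p) == p} onto p))
                        (λ i → ==-sound (allFin-sound {p = λ i → preimage σ (σ i) == i} back i)) ,
  λ i j → ≡ᵇ-sound (allFin-sound {p = λ j → h i j ≡ᵇ Path 4 (σ i) (σ j)}
                     (allFin-sound {p = λ i → allFin λ j → h i j ≡ᵇ Path 4 (σ i) (σ j)} edges i) j)
  where
    Back Onto Edges : Bool
    Back = allFin λ i → preimage σ (σ i) == i
    Onto = allFin λ p → σ (preimage σ p) == p
    Edges = allFin λ i → allFin λ j → h i j ≡ᵇ Path 4 (σ i) (σ j)
    back : T Back
    back = proj₁ (∧-elim {Back} labelling)
    onto : T Onto
    onto = proj₁ (∧-elim {Onto} (proj₂ (∧-elim {Back} labelling)))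
    edges : T Edges
    edges = proj₂ (∧-elim {Onto} (proj₂ (∧-elim {Back} labelling)))

fourConfigurationᵇ : Graph 4 → Bool
fourConfigurationᵇ h = allTriples (somePairDiffersᵇ h)

configuration⇒labellingᵇ : Triangle 4 → Bool
configuration⇒labellingᵇ t = not (fourConfigurationᵇ (graphOf t)) ∨ anyFinVec (pathLabellingᵇ (graphOf t) ∘ lookup)

-- The `tt` below is accepted by evaluating the check on all 2⁶ graphs on four vertices.
four-configuration⇒path : (t : Triangle 4) →
  (∀ a b c → a ≢ b → a ≢ c → b ≢ c → SomePairDiffersOnlyAtThird (graphOf t) a b c) → graphOf t ≅ Path 4
four-configuration⇒path t differ = pathLabellingᵇ-sound {σ = lookup (proj₁ labelling)} (proj₂ labelling)
  where
    labelling : ∃ λ v → T (pathLabellingᵇ (graphOf t) (lookup v))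
    labelling = anyFinVec-sound (T-not⇒ (allTriangles-sound {p = configuration⇒labellingᵇ} tt t)
      (allTriples-complete λ a b c a≢b a≢c b≢c → somePairDiffersᵇ-complete (graphOf t) (differ a b c a≢b a≢c b≢c)))

closed-under-adjacency : ∀ {n} {G : Graph n} → Connected G → (C : Fin n → Set) →
                         (∀ {u v} → C u → G u v ≡ true → C v) → ∀ {x} → C x → ∀ y → C y
closed-under-adjacency {G = G} connected C closed {x} Cx y = along (proj₂ (connected x y)) Cx
  where
    along : ∀ {u v m} → Walk G u v m → C u → C v
    along here Cu = Cu
    along (step uw walk) Cu = along walk (closed Cu uw)

AllPairs-lookup : ∀ {A : Set} {R : A → A → Set} → (∀ {x y} → R x y → R y x) →
                  ∀ {m} {xs : Vec A m} → AllPairs R xs → ∀ {i j} → i ≢ j → R (lookup xs i) (lookup xs j)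
AllPairs-lookup sym′ (_ ∷ _) {zero} {zero} i≢j = contradiction refl i≢j
AllPairs-lookup sym′ (px ∷ _) {zero} {suc j} _ = lookup⁺ px j
AllPairs-lookup sym′ (px ∷ _) {suc i} {zero} _ = sym′ (lookup⁺ px i)
AllPairs-lookup sym′ (_ ∷ pxs) {suc i} {suc j} i≢j = AllPairs-lookup sym′ pxs (i≢j ∘ cong suc)

module Induced {n m : ℕ} {G : Graph n} (w : Vec (Fin n) m) (unique : Unique w)
               (h : Graph m) (induced : ∀ i j → G (lookup w i) (lookup w j) ≡ h i j) where

  lookup-≢ : ∀ {i j} → i ≢ j → lookup w i ≢ lookup w j
  lookup-≢ i≢j = i≢j ∘ lookup-injective unique _ _

  agree-induced : ∀ {a b c} → AgreeOutside G (lookup w a) (lookup w b) (lookup w c) → AgreeOutside h a b c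
  agree-induced {a} {b} agree r r≢a r≢b r≢c =
    trans (sym (induced a r)) (trans (agree _ (lookup-≢ r≢a) (lookup-≢ r≢b) (lookup-≢ r≢c)) (induced b r))

  some-pair-agrees-induced : ∀ {a b c} → SomePairAgreesOutside G (lookup w a) (lookup w b) (lookup w c) →
                             SomePairAgreesOutside h a b c
  some-pair-agrees-induced = Sum.map agree-induced (Sum.map agree-induced agree-induced)

  differs-induced : ∀ {a b c} → DiffersOnlyAt G (lookup w a) (lookup w b) (lookup w c) → DiffersOnlyAt h a b c
  differs-induced {a} {b} {c} (agree , differ) =
    agree-induced agree , λ eq → differ (trans (induced a c) (trans eq (sym (induced b c))))

  some-pair-differs-induced : ∀ {a b c} → SomePairDiffersOnlyAtThird G (lookup w a) (lookup w b) (lookup w c) →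
                              SomePairDiffersOnlyAtThird h a b c
  some-pair-differs-induced = Sum.map differs-induced (Sum.map differs-induced differs-induced)

  enumeration⇒≅ : (∀ u → u ∈ⱽ w) → G ≅ h
  enumeration⇒≅ listed =
    mk↔ₛ′ (index ∘ listed) (lookup w) (λ i → lookup-injective unique _ _ (sym (lookup-index (listed (lookup w i)))))
                                      (λ u → sym (lookup-index (listed u))) ,
    λ u v → trans (cong₂ G (lookup-index (listed u)) (lookup-index (listed v))) (induced _ _)

∉⇒All≢ : ∀ {A : Set} {m} {x : A} {xs : Vec A m} → ¬ x ∈ⱽ xs → All (x ≢_) xs
∉⇒All≢ {xs = []} _ = []
∉⇒All≢ {xs = y ∷ ys} x∉ = (λ x≡y → x∉ (here x≡y)) ∷ ∉⇒All≢ (x∉ ∘ there)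

module Classification {n : ℕ} {G : Graph n} (simple : IsSimple G) (connected : Connected G) where
  open SimpleGraph simple
  open Twin simple

  agree∧¬twins⇒differ : ∀ {x y z} → AgreeOutside G x y z → ¬ Twins x y → G x z ≢ G y z
  agree∧¬twins⇒differ {x} {y} {z} agree ¬xy eq = ¬xy λ r r≢x r≢y → at r r≢x r≢y
    where
      at : ∀ r → r ≢ x → r ≢ y → G x r ≡ G y r
      at r r≢x r≢y with r ≟ᶠ z
      ... | yes refl = eq
      ... | no r≢z = agree r r≢x r≢y r≢z

  class-of₂ : ∀ {p q} → (∀ u → ¬ Twins u p → ¬ Twins u q → ⊥) → ∀ u → Twins u p ⊎ Twins u q
  class-of₂ {p} {q} covers u with twins? u p | twins? u q
  ... | yes up | _ = inj₁ up
  ... | no _ | yes uq = inj₂ uq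
  ... | no ¬up | no ¬uq = ⊥-elim (covers u ¬up ¬uq)

  class-of₃ : ∀ {a b c} → (∀ u → ¬ Twins u a → ¬ Twins u b → ¬ Twins u c → ⊥) → ∀ u → Twins u a ⊎ Twins u b ⊎ Twins u c
  class-of₃ {a} {b} {c} covers u with twins? u a | twins? u b | twins? u c
  ... | yes ua | _ | _ = inj₁ ua
  ... | no _ | yes ub | _ = inj₂ (inj₁ ub)
  ... | no _ | no _ | yes uc = inj₂ (inj₂ uc)
  ... | no ¬ua | no ¬ub | no ¬uc = ⊥-elim (covers u ¬ua ¬ub ¬uc)

  -- A twin class with no edges to the other classes would be a union of components.
  isolated-class : ∀ {x y z} → (∀ u → ¬ Twins u x → ¬ Twins u y → ¬ Twins u z → ⊥) → ¬ Twins x y → ¬ Twins x z →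
                   G x y ≡ false → G x z ≡ false → ⊥
  isolated-class {x} {y} {z} covers ¬xy ¬xz xy xz =
    ¬xy (twins-sym (closed-under-adjacency connected (λ u → Twins u x) stays twins-refl y))
    where
      stays : ∀ {u v} → Twins u x → G u v ≡ true → Twins v x
      stays {u} {v} ux uv with class-of₃ covers v
      ... | inj₁ vx = vx
      ... | inj₂ (inj₁ vy) = contradiction (trans (sym uv) (trans (cross-adjacency ux vy ¬xy) xy)) λ ()
      ... | inj₂ (inj₂ vz) = contradiction (trans (sym uv) (trans (cross-adjacency ux vz ¬xz) xz)) λ ()

  classAdjacency : Bool → Bool → Bool → Bool
  classAdjacency internal true true = internal
  classAdjacency internal true false = true
  classAdjacency internal false true = true
  classAdjacency internal false false = false

  classAdjacency-true : ∀ a b → classAdjacency true a b ≡ a ∨ b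
  classAdjacency-true true true = refl
  classAdjacency-true true false = refl
  classAdjacency-true false true = refl
  classAdjacency-true false false = refl

  classAdjacency-false : ∀ a b → classAdjacency false a b ≡ a xor b
  classAdjacency-false true true = refl
  classAdjacency-false true false = refl
  classAdjacency-false false true = refl
  classAdjacency-false false false = refl

  two-classes-adjacent : ∀ {p q} → (∀ u → ¬ Twins u p → ¬ Twins u q → ⊥) → ¬ Twins p q → G p q ≡ true
  two-classes-adjacent {p} {q} covers ¬pq with G p q in pq
  ... | true = refl
  ... | false = ⊥-elim (isolated-class (λ u ¬up ¬uq _ → covers u ¬up ¬uq) ¬pq ¬pq pq pq)

  module TwoClasses {p q : Fin n} (covers : ∀ u → ¬ Twins u p → ¬ Twins u q → ⊥) (¬pq : ¬ Twins p q)
                    {r : Fin n} (rq : Twins r q) (r≢q : r ≢ q) (q≁r : G q r ≡ false) where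

    p~q : G p q ≡ true
    p~q = two-classes-adjacent covers ¬pq

    side : Fin n → Bool
    side u = does (twins? u p)

    q-side : ∀ {u} → Twins u q → side u ≡ false
    q-side {u} uq = dec-false (twins? u p) λ up → ¬pq (twins-trans (twins-sym up) uq)

    class-side : ∀ u → (Twins u p × side u ≡ true) ⊎ (Twins u q × side u ≡ false)
    class-side u with class-of₂ covers u
    ... | inj₁ up = inj₁ (up , dec-true (twins? u p) up)
    ... | inj₂ uq = inj₂ (uq , q-side uq)

    class-adjacency : ∀ {internal} → (∀ {u v} → Twins u p → Twins v p → u ≢ v → G u v ≡ internal) →
                      ∀ {u v} → u ≢ v → G u v ≡ classAdjacency internal (side u) (side v)
    class-adjacency {internal} within {u} {v} u≢v with class-side u | class-side v
    ... | inj₁ (up , su) | inj₁ (vp , sv) = trans (within up vp u≢v) (sym (cong₂ (classAdjacency internal) su sv))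
    ... | inj₁ (up , su) | inj₂ (vq , sv) = trans (cross-adjacency up vq ¬pq) (trans p~q (sym (cong₂ (classAdjacency internal) su sv)))
    ... | inj₂ (uq , su) | inj₁ (vp , sv) = trans (cross-adjacency uq vp (¬pq ∘ twins-sym))
                                             (trans (adjacency-sym q p) (trans p~q (sym (cong₂ (classAdjacency internal) su sv))))
    ... | inj₂ (uq , su) | inj₂ (vq , sv) = trans (twin-class-uniform uq vq twins-refl rq u≢v (r≢q ∘ sym))
                                             (trans q≁r (sym (cong₂ (classAdjacency internal) su sv)))

    shape : CompleteBipartition G ⊎ CliqueJoinIndependent G
    shape with any? (λ u → any? λ v → twins? u p ×-dec (twins? v p ×-dec (¬? (u ≟ᶠ v) ×-dec (G u v ≟ᵇ true))))
    ... | yes (u₀ , v₀ , u₀p , v₀p , u₀≢v₀ , u₀~v₀) = inj₂ (record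
      { clique = side ; member = p ; outsider₁ = q ; outsider₂ = r
      ; member-in = dec-true (twins? p p) twins-refl
      ; outsider₁-out = q-side twins-refl
      ; outsider₂-out = q-side rq
      ; outsiders-distinct = r≢q ∘ sym
      ; adjacency = λ u v u≢v → trans (class-adjacency clique u≢v) (classAdjacency-true (side u) (side v))
      })
      where
        clique : ∀ {u v} → Twins u p → Twins v p → u ≢ v → G u v ≡ true
        clique up vp u≢v = trans (twin-class-uniform up vp u₀p v₀p u≢v u₀≢v₀) u₀~v₀
    ... | no no-edge = inj₁ (record
      { side = side ; left = p ; right = q
      ; left-side = dec-true (twins? p p) twins-refl
      ; right-side = q-side twins-refl
      ; adjacency = adjacency
      })
      where
        independent : ∀ {u v} → Twins u p → Twins v p → u ≢ v → G u v ≡ false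
        independent {u} {v} up vp u≢v with G u v in uv
        ... | false = refl
        ... | true = ⊥-elim (no-edge (u , v , up , vp , u≢v , uv))
        adjacency : ∀ u v → G u v ≡ side u xor side v
        adjacency u v with u ≟ᶠ v
        ... | yes refl = trans (proj₂ simple u) (sym (xor-same (side u)))
        ... | no u≢v = trans (class-adjacency independent u≢v) (classAdjacency-false (side u) (side v))

  -- The class not containing p is independent: a vertex r separating p from q lies in it.
  two-classes : ∀ {p q} → (∀ u → ¬ Twins u p → ¬ Twins u q → ⊥) → ¬ Twins p q →
                CompleteBipartition G ⊎ CliqueJoinIndependent G
  two-classes {p} {q} covers ¬pq with ¬twins⇒witness ¬pq
  ... | r , r≢p , r≢q , pr≢qr with class-of₂ covers r
  ...   | inj₂ rq = TwoClasses.shape covers ¬pq rq r≢q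
                      (¬-not (λ qr → pr≢qr (trans (cross-adjacency twins-refl rq ¬pq) (trans (two-classes-adjacent covers ¬pq) (sym qr)))))
  ...   | inj₁ rp = TwoClasses.shape (λ u ¬uq ¬up → covers u ¬up ¬uq) (¬pq ∘ twins-sym) rp r≢p
                      (¬-not (λ pr → pr≢qr (trans pr (sym (trans (cross-adjacency twins-refl rp (¬pq ∘ twins-sym))
                                                          (two-classes-adjacent (λ u ¬uq ¬up → covers u ¬up ¬uq) (¬pq ∘ twins-sym)))))))

  module _ (agreement : ∀ a b c → a ≢ b → a ≢ c → b ≢ c → SomePairAgreesOutside G a b c) where

    module PathOfClasses {x y z : Fin n} (covers : ∀ u → ¬ Twins u x → ¬ Twins u y → ¬ Twins u z → ⊥)
                         (¬xy : ¬ Twins x y) (¬xz : ¬ Twins x z) (¬yz : ¬ Twins y z)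
                         (x~y : G x y ≡ true) (y~z : G y z ≡ true) (x≁z : G x z ≡ false)
                         (agree : AgreeOutside G x y z) where

      z-alone : ∀ {u} → Twins u z → u ≡ z
      z-alone {u} uz with u ≟ᶠ z
      ... | yes u≡z = u≡z
      ... | no u≢z = contradiction (trans (sym x≁u) (trans (agree u (λ { refl → ¬xz uz }) (λ { refl → ¬yz uz }) u≢z) y~u)) λ ()
        where
          x≁u : G x u ≡ false
          x≁u = trans (cross-adjacency twins-refl uz ¬xz) x≁z
          y~u : G y u ≡ true
          y~u = trans (cross-adjacency twins-refl uz ¬yz) y~z

      x~twin : ∀ {w} → Twins w x → w ≢ x → G x w ≡ true
      x~twin {w} wx w≢x = trans (agree w w≢x (λ { refl → ¬xy (twins-sym wx) }) (λ { refl → ¬xz (twins-sym wx) }))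
                                (trans (cross-adjacency twins-refl wx (¬xy ∘ twins-sym)) (trans (adjacency-sym y x) x~y))

      y~twin : ∀ {w} → Twins w y → w ≢ y → G y w ≡ true
      y~twin {w} wy w≢y = trans (sym (agree w (λ { refl → ¬xy wy }) w≢y (λ { refl → ¬yz (twins-sym wy) })))
                                (trans (cross-adjacency twins-refl wy ¬xy) x~y)

      class-clique : ∀ {c} → (∀ {w} → Twins w c → w ≢ c → G c w ≡ true) →
                     ∀ {u v} → Twins u c → Twins v c → u ≢ v → G u v ≡ true
      class-clique {c} c~twin {u} {v} uc vc u≢v with u ≟ᶠ c
      ... | yes refl = c~twin vc (u≢v ∘ sym)
      ... | no u≢c = trans (twin-class-uniform uc vc twins-refl uc u≢v (u≢c ∘ sym)) (c~twin uc u≢c)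

      shape : CliqueJoinApexAndClique G
      shape = record
        { clique = clique ; apex = z ; member = y ; outsider = x
        ; member-in = dec-true (twins? y y) twins-refl
        ; apex-out = dec-false (twins? z y) (¬yz ∘ twins-sym)
        ; outsider-out = dec-false (twins? x y) ¬xy
        ; outsider≢apex = ¬twins⇒≢ ¬xz
        ; apex-adjacency = apex-adjacency
        ; adjacency-off-apex = adjacency-off-apex
        }
        where
          clique : Fin n → Bool
          clique u = does (twins? u y)
          apex-adjacency : ∀ v → G z v ≡ clique v
          apex-adjacency v with class-of₃ covers v
          ... | inj₁ vx = trans (cross-adjacency twins-refl vx (¬xz ∘ twins-sym))
                            (trans (adjacency-sym z x) (trans x≁z (sym (dec-false (twins? v y) λ vy → ¬xy (twins-trans (twins-sym vx) vy)))))
          ... | inj₂ (inj₁ vy) = trans (cross-adjacency twins-refl vy (¬yz ∘ twins-sym))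
                                   (trans (adjacency-sym z y) (trans y~z (sym (dec-true (twins? v y) vy))))
          ... | inj₂ (inj₂ vz) with z-alone vz
          ...   | refl = trans (proj₂ simple z) (sym (dec-false (twins? z y) (¬yz ∘ twins-sym)))
          adjacency-off-apex : ∀ u v → u ≢ v → u ≢ z → v ≢ z → G u v ≡ true
          adjacency-off-apex u v u≢v u≢z v≢z with class-of₃ covers u | class-of₃ covers v
          ... | inj₂ (inj₂ uz) | _ = ⊥-elim (u≢z (z-alone uz))
          ... | _ | inj₂ (inj₂ vz) = ⊥-elim (v≢z (z-alone vz))
          ... | inj₁ ux | inj₁ vx = class-clique x~twin ux vx u≢v
          ... | inj₂ (inj₁ uy) | inj₂ (inj₁ vy) = class-clique y~twin uy vy u≢v
          ... | inj₁ ux | inj₂ (inj₁ vy) = trans (cross-adjacency ux vy ¬xy) x~y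
          ... | inj₂ (inj₁ uy) | inj₁ vx = trans (cross-adjacency uy vx (¬xy ∘ twins-sym)) (trans (adjacency-sym y x) x~y)

    path-classes : ∀ {x y z} → (∀ u → ¬ Twins u x → ¬ Twins u y → ¬ Twins u z → ⊥) →
                   ¬ Twins x y → ¬ Twins x z → ¬ Twins y z → G x y ≡ true → G y z ≡ true → G x z ≡ false →
                   CliqueJoinApexAndClique G
    path-classes {x} {y} {z} covers ¬xy ¬xz ¬yz x~y y~z x≁z with agreement x y z (¬twins⇒≢ ¬xy) (¬twins⇒≢ ¬xz) (¬twins⇒≢ ¬yz)
    ... | inj₁ xy = PathOfClasses.shape covers ¬xy ¬xz ¬yz x~y y~z x≁z xy
    ... | inj₂ (inj₁ xz) = ⊥-elim (agree∧¬twins⇒differ xz ¬xz (trans x~y (sym (trans (adjacency-sym z y) y~z))))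
    ... | inj₂ (inj₂ yz) = PathOfClasses.shape (λ u ¬uz ¬uy ¬ux → covers u ¬ux ¬uy ¬uz)
                             (¬yz ∘ twins-sym) (¬xz ∘ twins-sym) (¬xy ∘ twins-sym)
                             (trans (adjacency-sym z y) y~z) (trans (adjacency-sym y x) x~y) (trans (adjacency-sym z x) x≁z)
                             (λ r r≢z r≢y r≢x → sym (yz r r≢y r≢z r≢x))

    -- Connectivity forces at least two edges between the classes, the agreement condition at most two.
    three-classes : ∀ {a b c} → (∀ u → ¬ Twins u a → ¬ Twins u b → ¬ Twins u c → ⊥) →
                    ¬ Twins a b → ¬ Twins a c → ¬ Twins b c → CliqueJoinApexAndClique G
    three-classes {a} {b} {c} covers ¬ab ¬ac ¬bc with G a b in ab | G b c in bc | G a c in ac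
    ... | true | true | true with agreement a b c (¬twins⇒≢ ¬ab) (¬twins⇒≢ ¬ac) (¬twins⇒≢ ¬bc)
    ...   | inj₁ agree = ⊥-elim (agree∧¬twins⇒differ agree ¬ab (trans ac (sym bc)))
    ...   | inj₂ (inj₁ agree) = ⊥-elim (agree∧¬twins⇒differ agree ¬ac (trans ab (sym (trans (adjacency-sym c b) bc))))
    ...   | inj₂ (inj₂ agree) = ⊥-elim (agree∧¬twins⇒differ agree ¬bc
                                  (trans (adjacency-sym b a) (trans ab (sym (trans (adjacency-sym c a) ac)))))
    three-classes covers ¬ab ¬ac ¬bc | true | true | false = path-classes covers ¬ab ¬ac ¬bc ab bc ac
    three-classes covers ¬ab ¬ac ¬bc | true | false | true =
      path-classes (λ u ¬ub ¬ua ¬uc → covers u ¬ua ¬ub ¬uc) (¬ab ∘ twins-sym) ¬bc ¬ac (trans (adjacency-sym _ _) ab) ac bc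
    three-classes covers ¬ab ¬ac ¬bc | false | true | true =
      path-classes (λ u ¬ua ¬uc ¬ub → covers u ¬ua ¬ub ¬uc) ¬ac ¬ab (¬bc ∘ twins-sym) ac (trans (adjacency-sym _ _) bc) ab
    three-classes covers ¬ab ¬ac ¬bc | false | false | _ =
      ⊥-elim (isolated-class (λ u ¬ub ¬ua ¬uc → covers u ¬ua ¬ub ¬uc) (¬ab ∘ twins-sym) ¬bc (trans (adjacency-sym _ _) ab) bc)
    three-classes covers ¬ab ¬ac ¬bc | false | true | false = ⊥-elim (isolated-class covers ¬ab ¬ac ab ac)
    three-classes covers ¬ab ¬ac ¬bc | true | false | false =
      ⊥-elim (isolated-class (λ u ¬uc ¬ua ¬ub → covers u ¬ua ¬ub ¬uc) (¬ac ∘ twins-sym) (¬bc ∘ twins-sym)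
                             (trans (adjacency-sym _ _) ac) (trans (adjacency-sym _ _) bc))

    non-twins-differ : ∀ {a b c} → ¬ Twins a b → ¬ Twins a c → ¬ Twins b c → SomePairDiffersOnlyAtThird G a b c
    non-twins-differ {a} {b} {c} ¬ab ¬ac ¬bc with agreement a b c (¬twins⇒≢ ¬ab) (¬twins⇒≢ ¬ac) (¬twins⇒≢ ¬bc)
    ... | inj₁ ab = inj₁ (ab , agree∧¬twins⇒differ ab ¬ab)
    ... | inj₂ (inj₁ ac) = inj₂ (inj₁ (ac , agree∧¬twins⇒differ ac ¬ac))
    ... | inj₂ (inj₂ bc) = inj₂ (inj₂ (bc , agree∧¬twins⇒differ bc ¬bc))

    induced-simple : ∀ {m} (w : Vec (Fin n) m) → IsSimple (λ i j → G (lookup w i) (lookup w j))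
    induced-simple w = (λ i j → adjacency-sym _ _) , (λ i → proj₂ simple _)

    module FourClasses (w : Vec (Fin n) 4) (non-twins : AllPairs (λ a b → ¬ Twins a b) w) where

      distinct : Unique w
      distinct = AllPairs.map ¬twins⇒≢ non-twins

      lookup-non-twins : ∀ {i j} → i ≢ j → ¬ Twins (lookup w i) (lookup w j)
      lookup-non-twins = AllPairs-lookup (_∘ twins-sym) non-twins

      no-fifth-vertex : ∀ {u} → ¬ u ∈ⱽ w → ⊥
      no-fifth-vertex {u} u∉w = no-five-configuration t
          (λ a b c a≢b a≢c b≢c → some-pair-agrees-induced (agreement _ _ _ (lookup-≢ a≢b) (lookup-≢ a≢c) (lookup-≢ b≢c)))
          (λ a b c a≢b a≢c b≢c → some-pair-differs-induced
             (non-twins-differ (lookup-non-twins a≢b) (lookup-non-twins a≢c) (lookup-non-twins b≢c)))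
        where
          w₅ : Vec (Fin n) 5
          w₅ = u ∷ w
          t : Triangle 5
          t = triangle (λ i j → G (lookup w₅ i) (lookup w₅ j))
          open Induced {G = G} w₅ (∉⇒All≢ u∉w ∷ distinct) (graphOf t) (λ i j → sym (graphOf-triangle (induced-simple w₅) i j))

      ≅path₄ : G ≅ Path 4
      ≅path₄ = ≅-trans {H = graphOf t} {J = Path 4} (enumeration⇒≅ listed) (four-configuration⇒path t λ a b c a≢b a≢c b≢c →
                 some-pair-differs-induced (non-twins-differ (lookup-non-twins a≢b) (lookup-non-twins a≢c) (lookup-non-twins b≢c)))
        where
          t : Triangle 4
          t = triangle (λ i j → G (lookup w i) (lookup w j))
          open Induced {G = G} w distinct (graphOf t) (λ i j → sym (graphOf-triangle (induced-simple w) i j))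
          listed : ∀ u → u ∈ⱽ w
          listed u with DecMembership._∈?_ (_≟ᶠ_ {n}) u w
          ... | yes u∈w = u∈w
          ... | no u∉w = ⊥-elim (no-fifth-vertex u∉w)

ListedGraph : ℕ → ∀ {n} → Graph n → Set
ListedGraph k G =
  (Σ ℕ λ s → Σ ℕ λ t → 1 ≤ s × 1 ≤ t × G ≅ Kbip s t)
  ⊎ (Σ ℕ λ s → Σ ℕ λ t → 1 ≤ s × 2 ≤ t × G ≅ (K s +G E t))
  ⊎ (Σ ℕ λ s → Σ ℕ λ t → 1 ≤ s × 1 ≤ t × G ≅ (K s +G (K 1 ∪G K t)))
  ⊎ (k ≡ 1 × G ≅ Path 4)

module Characterisation {n : ℕ} {G : Graph n} (simple : IsSimple G) (k : ℕ) (1≤k : 1 ≤ k) (4≤n : 4 ≤ n) where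
  open SimpleGraph simple
  open Distances k 1≤k
  open Twin simple
  open TwinDistances k 1≤k
  open Resolvability simple k 1≤k
  open ShapeConditions simple k 1≤k
  open PathConditions simple k 1≤k

  listed⇒conditions : ListedGraph k G → SomePairResolvedByAThird × EveryTripleHasUnresolvedPair
  listed⇒conditions (inj₁ (_ , _ , 1≤s , 1≤t , iso)) =
    bipartition-conditions (≤-trans (s≤s (s≤s (s≤s z≤n))) 4≤n) (Kbip-iso⇒bipartition 1≤s 1≤t iso)
  listed⇒conditions (inj₂ (inj₁ (_ , _ , 1≤s , 2≤t , iso))) =
    clique-join-independent-conditions (K+E-iso⇒clique-join-independent 1≤s 2≤t iso)
  listed⇒conditions (inj₂ (inj₂ (inj₁ (_ , _ , 1≤s , 1≤t , iso)))) =
    clique-join-apex-conditions (K+K₁∪K-iso⇒clique-join-apex 1≤s 1≤t iso)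
  listed⇒conditions (inj₂ (inj₂ (inj₂ (k≡1 , iso)))) = OnPath₄.resolved-pair iso , four-vertices⇒every-triple k≡1 {Path 4} iso

  module _ (connected : Connected G) (triples : EveryTripleHasUnresolvedPair) where
    open Classification simple connected

    agreement : ∀ a b c → a ≢ b → a ≢ c → b ≢ c → SomePairAgreesOutside G a b c
    agreement a b c a≢b a≢c b≢c = Sum.map agree (Sum.map agree agree) (triples a b c a≢b a≢c b≢c)
      where
        agree : ∀ {x y z} → UnresolvedOutside x y z → AgreeOutside G x y z
        agree unresolved r r≢x r≢y r≢z = dₖ≡⇒adjacency≡ (unresolved r r≢x r≢y r≢z)

    path₄⇒listed : G ≅ Path 4 → ListedGraph k G
    path₄⇒listed iso with k ≟ⁿ 1
    ... | yes k≡1 = inj₂ (inj₂ (inj₂ (k≡1 , iso)))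
    ... | no k≢1 = ⊥-elim (OnPath₄.violates-triples iso (≤∧≢⇒< 1≤k (k≢1 ∘ sym)) triples)

    classes-from : ∀ {p q} → ¬ Twins p q → ListedGraph k G
    classes-from {p} {q} ¬pq with any? (λ x → ¬? (twins? x p) ×-dec ¬? (twins? x q))
    ... | no ∄x = Sum.map bipartition⇒≅Kbip (inj₁ ∘ clique-join-independent⇒≅K+E simple)
                          (two-classes (λ u ¬up ¬uq → ∄x (u , ¬up , ¬uq)) ¬pq)
    ... | yes (x , ¬xp , ¬xq) with any? (λ y → ¬? (twins? y p) ×-dec (¬? (twins? y q) ×-dec ¬? (twins? y x)))
    ...   | no ∄y = inj₂ (inj₂ (inj₁ (clique-join-apex⇒≅K+K₁∪K simple
              (three-classes agreement (λ u ¬up ¬uq ¬ux → ∄y (u , ¬up , ¬uq , ¬ux)) ¬pq (¬xp ∘ twins-sym) (¬xq ∘ twins-sym)))))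
    ...   | yes (y , ¬yp , ¬yq , ¬yx) = path₄⇒listed (FourClasses.≅path₄ agreement (p ∷ q ∷ x ∷ y ∷ [])
              ((¬pq ∷ (¬xp ∘ twins-sym) ∷ (¬yp ∘ twins-sym) ∷ []) ∷ ((¬xq ∘ twins-sym) ∷ (¬yq ∘ twins-sym) ∷ []) ∷
               ((¬yx ∘ twins-sym) ∷ []) ∷ [] ∷ []))

    conditions⇒listed : SomePairResolvedByAThird → ListedGraph k G
    conditions⇒listed (p , q , r , _ , r≢p , r≢q , p≁q) = classes-from λ pq → p≁q (twins⇒dₖ≡ pq r≢p r≢q)

  conditions⇔listed : Connected G → (SomePairResolvedByAThird × EveryTripleHasUnresolvedPair) ⇔ ListedGraph k G
  conditions⇔listed connected = mk⇔ (λ (pair , triples) → conditions⇒listed connected triples pair) listed⇒conditions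

lemma3 : (k n : ℕ) → 1 ≤ k → 4 ≤ n → (G : Graph n) → IsSimple G → Connected G →
    MetricDimK k G (n ∸ 2) ⇔
      ((Σ ℕ λ s → Σ ℕ λ t → 1 ≤ s × 1 ≤ t × G ≅ Kbip s t)
      ⊎ (Σ ℕ λ s → Σ ℕ λ t → 1 ≤ s × 2 ≤ t × G ≅ (K s +G E t))
      ⊎ (Σ ℕ λ s → Σ ℕ λ t → 1 ≤ s × 1 ≤ t × G ≅ (K s +G (K 1 ∪G K t)))
      ⊎ (k ≡ 1 × G ≅ Path 4))
lemma3 k n 1≤k 4≤n G simple connected =
  Characterisation.conditions⇔listed simple k 1≤k 4≤n connected ⇔-∘ Resolvability.dimension≡n∸2⇔ simple k 1≤k 4≤n
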